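{- Let $k\ge 1$ and $\lambda \ge 1$ be integers and let $G$ be a finite partial $\lambda$-tree. Then Alice can always win the $k$-clique-relaxed coloring game on $G$ with $\left\lfloor \frac{3\lambda+2}{k}\right\rfloor + 1$ colors.
   Context: A partial $\lambda$-tree is a graph $G$ that is a subgraph of a chordal graph $H$ with $V(H)=V(G)$ and clique number $\omega(H)=\lambda+1$ (chordal: no induced cycle of length at least 4). The $k$-clique-relaxed $n$-coloring game on a finite graph $G$: there is a fixed set of $n$ colors; Alice moves first, and Alice and Bob alternately choose an uncolored vertex and assign it one of the $n$ colors, subject to the rule that at no point may there be a monochromatic clique on $k+1$ vertices. Alice wins if the game ends with all vertices colored; Bob wins if at some point an uncolored vertex has no legal color. -}

module Defs where

open import Data.Nat using (ℕ; zero; suc; _+_; _*_; _≤_; _%_; NonZero)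
open import Data.Nat.DivMod using (_/_)
open import Data.Fin using (Fin; toℕ; _≟_)
open import Data.Bool using (Bool; true; false)
open import Data.Maybe using (Maybe; just; nothing)
open import Data.Product using (Σ; ∃; _×_; _,_)
open import Data.Sum using (_⊎_)
open import Data.Empty using (⊥)
open import Relation.Nullary using (¬_; yes; no)
open import Relation.Binary.PropositionalEquality using (_≡_; _≢_)
open import Function.Definitions using (Injective)

record Graph (n : ℕ) : Set where
  field
    adj      : Fin n → Fin n → Bool
    symmetric : ∀ u v → adj u v ≡ adj v u
    irreflexive : ∀ v → adj v v ≡ false

open Graph public

Adj : ∀ {n} → Graph n → Fin n → Fin n → Set
Adj G u v = adj G u v ≡ true

_⊆G_ : ∀ {n} → Graph n → Graph n → Set
G ⊆G H = ∀ u v → Adj G u v → Adj H u v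

IsClique : ∀ {n s} → Graph n → (Fin s → Fin n) → Set
IsClique G f = Injective _≡_ _≡_ f × (∀ i j → i ≢ j → Adj G (f i) (f j))

HasClique : ∀ {n} → Graph n → ℕ → Set
HasClique {n} G s = Σ (Fin s → Fin n) (IsClique G)

CliqueNumber : ∀ {n} → Graph n → ℕ → Set
CliqueNumber G w = HasClique G w × ¬ HasClique G (suc w)

CycSucc : ∀ {m} → Fin m → Fin m → Set
CycSucc {m} i j = (suc (toℕ i) ≡ toℕ j) ⊎ ((suc (toℕ i) ≡ m) × (toℕ j ≡ 0))

CycAdj : ∀ {m} → Fin m → Fin m → Set
CycAdj i j = CycSucc i j ⊎ CycSucc j i

InducedCycle : ∀ {n m} → Graph n → (Fin m → Fin n) → Set
InducedCycle {m = m} G f =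
  Injective _≡_ _≡_ f × (∀ i j → (Adj G (f i) (f j) → CycAdj i j) × (CycAdj i j → Adj G (f i) (f j)))

Chordal : ∀ {n} → Graph n → Set
Chordal {n} G = ∀ m → 4 ≤ m → (f : Fin m → Fin n) → ¬ InducedCycle G f

PartialTree : ∀ {n} → ℕ → Graph n → Set
PartialTree {n} l G = Σ (Graph n) λ H → Chordal H × G ⊆G H × CliqueNumber H (suc l)

Colouring : ℕ → ℕ → Set
Colouring n c = Fin n → Maybe (Fin c)

MonoClique : ∀ {n c} → Graph n → ℕ → Colouring n c → Set
MonoClique {n} {c} G k σ =
  Σ (Fin (suc k) → Fin n) λ f → IsClique G f × ∃ λ (col : Fin c) → ∀ i → σ (f i) ≡ just col

Legal : ∀ {n c} → Graph n → ℕ → Colouring n c → Set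
Legal G k σ = ¬ MonoClique G k σ

update : ∀ {n c} → Colouring n c → Fin n → Fin c → Colouring n c
update σ v a w with w ≟ v
... | yes _ = just a
... | no  _ = σ w

Complete : ∀ {n c} → Colouring n c → Set
Complete σ = ∀ v → ∃ λ a → σ v ≡ just a

-- some uncoloured vertex has no legal colour (Bob wins at this point)
Stuck : ∀ {n c} → Graph n → ℕ → Colouring n c → Set
Stuck {c = c} G k σ = ∃ λ v → (σ v ≡ nothing) × (∀ (a : Fin c) → ¬ Legal G k (update σ v a))

-- AliceWinsA: Alice to move and she can force a win;
-- AliceWinsB: Bob to move and Alice can force a win.
mutual
  data AliceWinsA {n c} (G : Graph n) (k : ℕ) (σ : Colouring n c) : Set where
    finished : Complete σ → AliceWinsA G k σ
    move     : ¬ Stuck G k σ → (v : Fin n) (a : Fin c) → σ v ≡ nothing →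
               Legal G k (update σ v a) → AliceWinsB G k (update σ v a) →
               AliceWinsA G k σ

  data AliceWinsB {n c} (G : Graph n) (k : ℕ) (σ : Colouring n c) : Set where
    finished : Complete σ → AliceWinsB G k σ
    move     : ¬ Stuck G k σ →
               (∀ (v : Fin n) (a : Fin c) → σ v ≡ nothing →
                  Legal G k (update σ v a) → AliceWinsA G k (update σ v a)) →
               AliceWinsB G k σ

empty : ∀ {n c} → Colouring n c
empty _ = nothing

AliceWins : ∀ {n} → Graph n → (k c : ℕ) → Set
AliceWins G k c = AliceWinsA {c = c} G k empty

-- A chordal graph H has a perfect elimination order (by Dirac's lemma: a chordal graph that is
-- not complete has a simplicial vertex outside the closed neighbourhood of any given vertex), and
-- when ω(H) = λ + 1 every vertex has at most λ earlier neighbours in it.  Alice plays the activation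
-- strategy along this order: starting from the vertex Bob just coloured, she activates the current
-- vertex and moves to the earliest uncoloured vertex among it and its earlier neighbours, until she
-- reaches an active uncoloured vertex, which she colours.  For every uncoloured v this keeps
--   #(active later neighbours) ≤ #(active earlier) + #(coloured earlier) + [v active],
-- so v has at most 2λ + 2 coloured later and λ coloured earlier neighbours.  With c colours and
-- c·k > 3λ + 2 some colour occurs on fewer than k neighbours of v, and that colour is legal for v.

module Submission where

open import Defs
open import Data.Bool using (Bool; true; false; _∧_; _∨_; not; T; if_then_else_)
open import Data.Bool.Properties using (not-¬; ¬-not; ∧-identityʳ; ∧-zeroʳ) renaming (_≟_ to _≟ᵇ_)
open import Data.Empty using (⊥-elim)
open import Data.Fin using (Fin; zero; suc; toℕ; punchIn; punchOut; inject≤) renaming (_≟_ to _≟ᶠ_)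
open import Data.Fin.Properties
  using (any?; all?; ¬∀⟶∃¬; punchIn-injective; punchInᵢ≢i; punchOut-injective; punchIn-punchOut;
         toℕ-injective; toℕ<n; inject≤-injective)
  renaming (suc-injective to Fin-suc-injective)
open import Data.Maybe using (Maybe; just; nothing; is-just)
open import Data.Maybe.Properties using (just-injective)
open import Data.Nat using (ℕ; zero; suc; _+_; _*_; _∸_; _≤_; _<_; _≤ᵇ_; z≤n; s≤s; s≤s⁻¹; _<?_; _≤?_; NonZero)
open import Data.Nat.DivMod using (_/_; _%_; m≡m%n+[m/n]*n; m%n<n)
open import Data.Nat.Properties
open import Data.Nat.Induction using (<-rec)
open import Data.Nat.Tactic.RingSolver using (solve-∀)
open import Data.Product using (Σ; ∃; ∃₂; _×_; _,_; proj₁; proj₂)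
open import Data.Sum using (_⊎_; inj₁; inj₂)
open import Data.Unit using (tt)
open import Function using (_∘_; case_of_)
open import Function.Definitions using (Injective)
open import Relation.Binary.Definitions using (tri<; tri≈; tri>)
open import Relation.Binary.PropositionalEquality
open import Relation.Nullary using (¬_; yes; no; Dec; does)
open import Relation.Nullary.Decidable using (_×-dec_; _⊎-dec_; ¬?; dec-true; dec-false)
open import Algebra.Properties.CommutativeSemigroup +-commutativeSemigroup using (interchange; x∙yz≈y∙xz)
open import Algebra.Properties.CommutativeMonoid.Sum +-0-commutativeMonoid using (sum; sum-cong-≗; ∑-comm)

∧-intro : ∀ {a b} → a ≡ true → b ≡ true → a ∧ b ≡ true
∧-intro refl refl = refl

∧-elimˡ : ∀ {a b} → a ∧ b ≡ true → a ≡ true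
∧-elimˡ {true} _ = refl

∧-elimʳ : ∀ {a b} → a ∧ b ≡ true → b ≡ true
∧-elimʳ {true} e = e

∨-introˡ : ∀ {a b} → a ≡ true → a ∨ b ≡ true
∨-introˡ refl = refl

∨-introʳ : ∀ {a b} → b ≡ true → a ∨ b ≡ true
∨-introʳ {true} _ = refl
∨-introʳ {false} e = e

∨-elim : ∀ {a b} → a ∨ b ≡ true → a ≡ true ⊎ b ≡ true
∨-elim {true} _ = inj₁ refl
∨-elim {false} e = inj₂ e

not-elim : ∀ {b} → not b ≡ true → b ≡ false
not-elim {false} _ = refl

does-witness : ∀ {A : Set} (a? : Dec A) → does a? ≡ true → A
does-witness (yes a) _ = a

-- Vertex sets, as Boolean predicates so that they can be counted

VSet : ℕ → Set
VSet n = Fin n → Bool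

module _ {n : ℕ} where

  infix 4 _∈_ _∉_ _⊆_
  infixr 7 _∩_
  infixr 6 _∪_

  _∈_ : Fin n → VSet n → Set
  x ∈ p = p x ≡ true

  _∉_ : Fin n → VSet n → Set
  x ∉ p = p x ≡ false

  _⊆_ : VSet n → VSet n → Set
  p ⊆ q = ∀ u → u ∈ p → u ∈ q

  ⁅_⁆ : Fin n → VSet n
  ⁅ x ⁆ u = does (u ≟ᶠ x)

  ∁ : VSet n → VSet n
  ∁ p u = not (p u)

  _∩_ : VSet n → VSet n → VSet n
  (p ∩ q) u = p u ∧ q u

  _∪_ : VSet n → VSet n → VSet n
  (p ∪ q) u = p u ∨ q u

  x∈⁅x⁆ : ∀ x → x ∈ ⁅ x ⁆
  x∈⁅x⁆ x = dec-true (x ≟ᶠ x) refl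

  x∉⁅y⁆ : ∀ {x y} → x ≢ y → x ∉ ⁅ y ⁆
  x∉⁅y⁆ {x} {y} = dec-false (x ≟ᶠ y)

  x∈⁅y⁆⇒x≡y : ∀ {x y} → x ∈ ⁅ y ⁆ → x ≡ y
  x∈⁅y⁆⇒x≡y {x} {y} = does-witness (x ≟ᶠ y)

∁-antitone : ∀ {n} {p q : VSet n} → p ⊆ q → ∁ q ⊆ ∁ p
∁-antitone {p = p} p⊆q u u∈∁q with p u in pu
... | false = refl
... | true = ⊥-elim (not-¬ (p⊆q u pu) (not-elim u∈∁q))

iverson : Bool → ℕ
iverson true = 1
iverson false = 0

count : ∀ {n} → VSet n → ℕ
count p = sum (iverson ∘ p)

iverson≤1 : ∀ b → iverson b ≤ 1
iverson≤1 true = ≤-refl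
iverson≤1 false = z≤n

iverson-mono : ∀ {a b} → (a ≡ true → b ≡ true) → iverson a ≤ iverson b
iverson-mono {false} _ = z≤n
iverson-mono {true} h rewrite h refl = ≤-refl

iverson≤ : ∀ {b s} → (b ≡ true → 1 ≤ s) → iverson b ≤ s
iverson≤ {false} _ = z≤n
iverson≤ {true} h = h refl

sum-mono : ∀ {n} {f g : Fin n → ℕ} → (∀ i → f i ≤ g i) → sum f ≤ sum g
sum-mono {zero} _ = z≤n
sum-mono {suc n} f≤g = +-mono-≤ (f≤g zero) (sum-mono (f≤g ∘ suc))

sum-const : ∀ n k → sum {n} (λ _ → k) ≡ n * k
sum-const zero k = refl
sum-const (suc n) k = cong (k +_) (sum-const n k)

count≤n : ∀ {n} (p : VSet n) → count p ≤ n
count≤n {n} p = ≤-trans (sum-mono (iverson≤1 ∘ p)) (≤-reflexive (trans (sum-const n 1) (*-identityʳ n)))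

count-mono : ∀ {n} {p q : VSet n} → p ⊆ q → count p ≤ count q
count-mono p⊆q = sum-mono (λ u → iverson-mono (p⊆q u))

count-cong : ∀ {n} {p q : VSet n} → (∀ u → p u ≡ q u) → count p ≡ count q
count-cong p≗q = sum-cong-≗ (cong iverson ∘ p≗q)

count-∅ : ∀ n → count {n} (λ _ → false) ≡ 0
count-∅ n = trans (sum-const n 0) (*-zeroʳ n)

count-pos : ∀ {n} {p : VSet n} x → x ∈ p → 1 ≤ count p
count-pos {suc n} {p} zero e rewrite e = s≤s z≤n
count-pos {suc n} {p} (suc x) e = ≤-trans (count-pos x e) (m≤n+m _ (iverson (p zero)))

count-split : ∀ {n} (p q : VSet n) x → (∀ u → u ≢ x → p u ≡ q u) → x ∉ q →
              count p ≡ iverson (p x) + count q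
count-split {suc n} p q zero p≗q qx rewrite qx =
  cong (iverson (p zero) +_) (count-cong (λ u → p≗q (suc u) (λ ())))
count-split {suc n} p q (suc x) p≗q qx
  rewrite p≗q zero (λ ())
        | count-split (p ∘ suc) (q ∘ suc) x (λ u u≢x → p≗q (suc u) (u≢x ∘ Fin-suc-injective)) qx
  = x∙yz≈y∙xz (iverson (q zero)) (iverson (p (suc x))) _

count-strict : ∀ {n} {p q : VSet n} x → p ⊆ q → x ∈ q → x ∉ p → suc (count p) ≤ count q
count-strict {suc n} {p} {q} zero p⊆q qx px rewrite qx | px = s≤s (count-mono (p⊆q ∘ suc))
count-strict {suc n} {p} {q} (suc x) p⊆q qx px =
  ≤-trans (≤-reflexive (sym (+-suc (iverson (p zero)) _)))
          (+-mono-≤ (iverson-mono (p⊆q zero)) (count-strict x (p⊆q ∘ suc) qx px))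

count-∪ : ∀ {n} (p q : VSet n) → count (p ∪ q) ≤ count p + count q
count-∪ {zero} p q = z≤n
count-∪ {suc n} p q =
  ≤-trans (+-mono-≤ (iverson-∨ (p zero) (q zero)) (count-∪ (p ∘ suc) (q ∘ suc)))
          (≤-reflexive (interchange (iverson (p zero)) _ _ _))
  where
  iverson-∨ : ∀ a b → iverson (a ∨ b) ≤ iverson a + iverson b
  iverson-∨ true b = s≤s z≤n
  iverson-∨ false b = ≤-refl

count-⁅⁆∩ : ∀ {n} (x : Fin n) (p : VSet n) → count (⁅ x ⁆ ∩ p) ≡ iverson (p x)
count-⁅⁆∩ {n} x p = begin
  count (⁅ x ⁆ ∩ p)                                ≡⟨ count-split (⁅ x ⁆ ∩ p) (λ _ → false) x outside refl ⟩
  iverson (⁅ x ⁆ x ∧ p x) + count {n} (λ _ → false) ≡⟨ cong₂ (λ b m → iverson (b ∧ p x) + m) (x∈⁅x⁆ x) (count-∅ n) ⟩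
  iverson (p x) + 0                                ≡⟨ +-identityʳ _ ⟩
  iverson (p x)                                    ∎
  where
  open ≡-Reasoning
  outside : ∀ u → u ≢ x → (⁅ x ⁆ ∩ p) u ≡ false
  outside u u≢x = cong (_∧ p u) (x∉⁅y⁆ u≢x)

count-insert : ∀ {n} {x : Fin n} (A P : VSet n) → x ∉ A → count ((⁅ x ⁆ ∪ A) ∩ P) ≡ iverson (P x) + count (A ∩ P)
count-insert {x = x} A P x∉A =
  trans (count-split ((⁅ x ⁆ ∪ A) ∩ P) (A ∩ P) x (λ u u≢x → cong (λ b → (b ∨ A u) ∧ P u) (x∉⁅y⁆ u≢x))
                     (cong (_∧ P x) x∉A))
        (cong (λ b → iverson ((b ∨ A x) ∧ P x) + count (A ∩ P)) (x∈⁅x⁆ x))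

count-remove : ∀ {n} {p : VSet n} {x} → x ∈ p → count p ≡ suc (count (p ∩ ∁ ⁅ x ⁆))
count-remove {p = p} {x} x∈p =
  trans (count-split p (p ∩ ∁ ⁅ x ⁆) x p≗p∖x x∉p∖x) (cong (λ b → iverson b + count (p ∩ ∁ ⁅ x ⁆)) x∈p)
  where
  p≗p∖x : ∀ u → u ≢ x → p u ≡ (p ∩ ∁ ⁅ x ⁆) u
  p≗p∖x u u≢x = trans (sym (∧-identityʳ (p u))) (cong (λ b → p u ∧ not b) (sym (x∉⁅y⁆ u≢x)))
  x∉p∖x : x ∉ p ∩ ∁ ⁅ x ⁆
  x∉p∖x = trans (cong (λ b → p x ∧ not b) (x∈⁅x⁆ x)) (∧-zeroʳ (p x))

argmin : ∀ {n} (f : Fin n → ℕ) (p : VSet n) → (∃ λ y → y ∈ p × ∀ z → z ∈ p → f y ≤ f z) ⊎ (∀ z → z ∉ p)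
argmin {zero} f p = inj₂ λ ()
argmin {suc n} f p with argmin (f ∘ suc) (p ∘ suc) | p zero in p0
... | inj₂ none | false = inj₂ λ { zero → p0 ; (suc z) → none z }
... | inj₂ none | true = inj₁ (zero , p0 , λ { zero _ → ≤-refl ; (suc z) e → ⊥-elim (not-¬ e (none z)) })
... | inj₁ (y , py , y-min) | false = inj₁ (suc y , py , λ { zero e → ⊥-elim (not-¬ e p0) ; (suc z) e → y-min z e })
... | inj₁ (y , py , y-min) | true with f zero ≤? f (suc y)
...   | yes ≤y = inj₁ (zero , p0 , λ { zero _ → ≤-refl ; (suc z) e → ≤-trans ≤y (y-min z e) })
...   | no ≰y = inj₁ (suc y , py , λ { zero _ → <⇒≤ (≰⇒> ≰y) ; (suc z) e → y-min z e })

count-injection : ∀ {m n} (p : VSet n) (f : Fin m → Fin n) → Injective _≡_ _≡_ f →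
                  (∀ i → f i ∈ p) → m ≤ count p
count-injection {zero} p f _ _ = z≤n
count-injection {suc m} {zero} p f _ _ with f zero
... | ()
count-injection {suc m} {suc n} p f f-inj f∈p with any? (λ i → f i ≟ᶠ zero)
... | yes (i , fi≡0) = ≤-trans (s≤s (count-injection (p ∘ suc) g g-inj g∈p))
                               (≤-reflexive (cong (λ b → iverson b + count (p ∘ suc)) (sym p0)))
  where
  f≢0 : ∀ j → zero ≢ f (punchIn i j)
  f≢0 j e = punchInᵢ≢i i j (f-inj (trans (sym e) (sym fi≡0)))
  g : Fin m → Fin n
  g j = punchOut (f≢0 j)
  g-inj : Injective _≡_ _≡_ g
  g-inj {a} {b} e = punchIn-injective i a b (f-inj (punchOut-injective (f≢0 a) (f≢0 b) e))
  g∈p : ∀ j → suc (g j) ∈ p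
  g∈p j = trans (cong p (punchIn-punchOut (f≢0 j))) (f∈p (punchIn i j))
  p0 : p zero ≡ true
  p0 = trans (cong p (sym fi≡0)) (f∈p i)
... | no f≢0 = ≤-trans (count-injection (p ∘ suc) g g-inj g∈p) (m≤n+m _ (iverson (p zero)))
  where
  0≢f : ∀ j → zero ≢ f j
  0≢f j e = f≢0 (j , sym e)
  g : Fin (suc m) → Fin n
  g j = punchOut (0≢f j)
  g-inj : Injective _≡_ _≡_ g
  g-inj {a} {b} e = f-inj (punchOut-injective (0≢f a) (0≢f b) e)
  g∈p : ∀ j → suc (g j) ∈ p
  g∈p j = trans (cong p (punchIn-punchOut (0≢f j))) (f∈p j)

enumerate : ∀ {n} (p : VSet n) → Σ (Fin (count p) → Fin n) λ f → Injective _≡_ _≡_ f × (∀ i → f i ∈ p)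
enumerate {zero} p = (λ ()) , (λ {i} → λ { {()} }) , λ ()
enumerate {suc n} p with enumerate (p ∘ suc) | p zero in p0
... | g , g-inj , g∈p | false = suc ∘ g , g-inj ∘ Fin-suc-injective , g∈p
... | g , g-inj , g∈p | true = f , f-inj , f∈p
  where
  f : Fin (suc (count (p ∘ suc))) → Fin (suc n)
  f zero = zero
  f (suc i) = suc (g i)
  f-inj : Injective _≡_ _≡_ f
  f-inj {zero} {zero} _ = refl
  f-inj {suc a} {suc b} e = cong suc (g-inj (Fin-suc-injective e))
  f∈p : ∀ i → f i ∈ p
  f∈p zero = p0
  f∈p (suc i) = g∈p i

∑-count≤count : ∀ {c n} (q : Fin c → VSet n) (r : VSet n) →
                (∀ u → sum (λ a → iverson (q a u)) ≤ iverson (r u)) → sum (λ a → count (q a)) ≤ count r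
∑-count≤count q r h = ≤-trans (≤-reflexive (∑-comm (λ a u → iverson (q a u)))) (sum-mono h)

anyᵇ : ∀ {n} → VSet n → Bool
anyᵇ {zero} p = false
anyᵇ {suc n} p = p zero ∨ anyᵇ (p ∘ suc)

anyᵇ-intro : ∀ {n} {p : VSet n} x → x ∈ p → anyᵇ p ≡ true
anyᵇ-intro zero e = ∨-introˡ e
anyᵇ-intro {p = p} (suc x) e = ∨-introʳ {p zero} (anyᵇ-intro x e)

anyᵇ-elim : ∀ {n} (p : VSet n) → anyᵇ p ≡ true → ∃ (_∈ p)
anyᵇ-elim {suc n} p e with ∨-elim {p zero} e
... | inj₁ p0 = zero , p0
... | inj₂ rest with anyᵇ-elim (p ∘ suc) rest
...   | x , px = suc x , px

anyᵇ-cong : ∀ {n} {p q : VSet n} → (∀ u → p u ≡ q u) → anyᵇ p ≡ anyᵇ q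
anyᵇ-cong {zero} _ = refl
anyᵇ-cong {suc n} p≗q = cong₂ _∨_ (p≗q zero) (anyᵇ-cong (p≗q ∘ suc))

-- Each step that changes the set adds an element, so n + 1 steps reach a fixed point.
module Closure {n : ℕ} (grow : VSet n → VSet n) (inflationary : ∀ P → P ⊆ grow P)
                (grow-cong : ∀ {P Q} → (∀ u → P u ≡ Q u) → ∀ u → grow P u ≡ grow Q u) where

  iterate : ℕ → VSet n → VSet n
  iterate zero P = P
  iterate (suc i) P = grow (iterate i P)

  ⊆-iterate : ∀ i P → P ⊆ iterate i P
  ⊆-iterate zero P _ e = e
  ⊆-iterate (suc i) P u e = inflationary (iterate i P) u (⊆-iterate i P u e)

  closure : VSet n → VSet n
  closure = iterate (suc n)

  closure-stable : ∀ P u → grow (closure P) u ≡ closure P u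
  closure-stable P with stable-or-growing (suc n)
    where
    Stable : ℕ → Set
    Stable i = ∀ u → iterate (suc i) P u ≡ iterate i P u
    stable-or-growing : ∀ i → Stable i ⊎ i ≤ count (iterate i P)
    stable-or-growing zero = inj₂ z≤n
    stable-or-growing (suc i) with stable-or-growing i
    ... | inj₁ stable = inj₁ (grow-cong stable)
    ... | inj₂ i≤count with all? (λ u → iterate (suc i) P u ≟ᵇ iterate i P u)
    ...   | yes stable = inj₁ (grow-cong stable)
    ...   | no unstable with ¬∀⟶∃¬ n _ (λ u → iterate (suc i) P u ≟ᵇ iterate i P u) unstable
    ...     | u , changed = inj₂ (≤-trans (s≤s i≤count)
                                 (count-strict u (inflationary (iterate i P)) (proj₁ new) (proj₂ new)))
      where
      gained : ∀ a b → b ≢ a → (a ≡ true → b ≡ true) → b ≡ true × a ≡ false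
      gained false true _ _ = refl , refl
      gained false false b≢a _ = ⊥-elim (b≢a refl)
      gained true b b≢a a⇒b = ⊥-elim (b≢a (a⇒b refl))
      new : u ∈ iterate (suc i) P × u ∉ iterate i P
      new = gained (iterate i P u) (iterate (suc i) P u) changed (inflationary (iterate i P) u)
  ... | inj₁ stable = stable
  ... | inj₂ too-big = ⊥-elim (<⇒≱ too-big (count≤n (closure P)))

-- Detours in chordal graphs

splice : ∀ {A : Set} → ℕ → (ℕ → A) → (ℕ → A) → ℕ → A
splice i x y k = if k ≤ᵇ i then x k else y k

splice-≤ : ∀ {A : Set} {i k} (x y : ℕ → A) → k ≤ i → splice i x y k ≡ x k
splice-≤ {i = i} {k = k} x y k≤i with k ≤ᵇ i | ≤⇒≤ᵇ k≤i
... | true | _ = refl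

splice-> : ∀ {A : Set} {i k} (x y : ℕ → A) → i < k → splice i x y k ≡ y k
splice-> {i = i} {k = k} x y i<k with k ≤ᵇ i in eq
... | false = refl
... | true = ⊥-elim (<⇒≱ i<k (≤ᵇ⇒≤ k i (subst T (sym eq) tt)))

module _ {n : ℕ} (H : Graph n) where

  Adj-sym : ∀ {a b} → Adj H a b → Adj H b a
  Adj-sym {a} {b} e = trans (symmetric H b a) e

  Adj-irrefl : ∀ {a b} → a ≡ b → ¬ Adj H a b
  Adj-irrefl {a} refl e = not-¬ e (irreflexive H a)

  IsWalk : ℕ → (ℕ → Fin n) → Set
  IsWalk m x = ∀ i → i < m → Adj H (x i) (x (suc i))

  IsDetour : VSet n → Fin n → Fin n → ℕ → (ℕ → Fin n) → Set
  IsDetour P a b m x = x 0 ≡ a × x m ≡ b × IsWalk m x × (∀ i → 0 < i → i < m → x i ∈ P)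

  -- Cutting out x (i+1), …, x (i+d) leaves a detour, provided x i may stand in for x (i+d).
  shortcut : ∀ {P a b} m x → IsDetour P a b m x → ∀ i d → 1 ≤ d → i + d ≤ m →
             (i + d ≡ m → x i ≡ x m) → (i + d < m → Adj H (x i) (x (suc (i + d)))) →
             ∃ λ m′ → m′ < m × ∃ (IsDetour P a b m′)
  shortcut {P} {a} {b} m x (x0 , xm , walk , inner) i d 1≤d i+d≤m last next = m ∸ d , m∸d<m , y , y0 , ym , y-walk , y-inner
    where
    shifted : ℕ → Fin n
    shifted k = x (k + d)
    y : ℕ → Fin n
    y = splice i x shifted
    m′ : ℕ
    m′ = m ∸ d
    m′+d : m′ + d ≡ m
    m′+d = m∸n+n≡m (≤-trans (m≤n+m d i) i+d≤m)
    m∸d<m : m′ < m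
    m∸d<m = subst (m′ <_) m′+d (m<m+n m′ 1≤d)
    i≤m′ : i ≤ m′
    i≤m′ = +-cancelʳ-≤ d i m′ (subst (i + d ≤_) (sym m′+d) i+d≤m)
    shift< : ∀ {k} → k < m′ → k + d < m
    shift< k<m′ = subst (_ <_) m′+d (+-monoˡ-< d k<m′)
    y0 : y 0 ≡ a
    y0 = trans (splice-≤ {i = i} x shifted z≤n) x0
    ym : y m′ ≡ b
    ym with m≤n⇒m<n∨m≡n i≤m′
    ... | inj₁ i<m′ = trans (splice-> x shifted i<m′) (trans (cong x m′+d) xm)
    ... | inj₂ refl = trans (splice-≤ x shifted ≤-refl) (trans (last m′+d) xm)
    y-walk : IsWalk m′ y
    y-walk k k<m′ with <-cmp k i
    ... | tri< k<i _ _ = subst₂ (Adj H) (sym (splice-≤ x shifted (<⇒≤ k<i))) (sym (splice-≤ x shifted k<i))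
                           (walk k (<-≤-trans k<i (≤-trans (m≤m+n i d) i+d≤m)))
    ... | tri≈ _ refl _ = subst₂ (Adj H) (sym (splice-≤ x shifted ≤-refl)) (sym (splice-> x shifted ≤-refl)) (next (shift< k<m′))
    ... | tri> _ _ i<k = subst₂ (Adj H) (sym (splice-> x shifted i<k)) (sym (splice-> x shifted (m<n⇒m<1+n i<k)))
                           (walk (k + d) (shift< k<m′))
    y-inner : ∀ k → 0 < k → k < m′ → y k ∈ P
    y-inner k 0<k k<m′ with <-cmp k i
    ... | tri< k<i _ _ = trans (cong P (splice-≤ x shifted (<⇒≤ k<i))) (inner k 0<k (<-≤-trans k<i (≤-trans (m≤m+n i d) i+d≤m)))
    ... | tri≈ _ refl _ = trans (cong P (splice-≤ x shifted ≤-refl)) (inner k 0<k (<-≤-trans k<m′ (m∸n≤m m d)))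
    ... | tri> _ _ i<k = trans (cong P (splice-> x shifted i<k)) (inner (k + d) (<-≤-trans 0<k (m≤m+n k d)) (shift< k<m′))

  -- A repeated vertex or a chord: what a shortest detour cannot have.
  Skip : (ℕ → Fin n) → ℕ → ℕ → Set
  Skip x i j = x i ≡ x j ⊎ (suc i < j × Adj H (x i) (x j))

  skip? : ∀ x i j → Dec (Skip x i j)
  skip? x i j = (x i ≟ᶠ x j) ⊎-dec ((suc i <? j) ×-dec (adj H (x i) (x j) ≟ᵇ true))

  skip-shortcut : ∀ {P a b} m x → IsDetour P a b m x → ∀ {i j} → i < j → j ≤ m → Skip x i j →
                  ∃ λ m′ → m′ < m × ∃ (IsDetour P a b m′)
  skip-shortcut {P} m x d@(_ , _ , walk , _) {i} {j} i<j j≤m (inj₁ xi≡xj) =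
    shortcut {P} m x d i (j ∸ i) (m<n⇒0<n∸m i<j) (subst (_≤ m) (sym i+d≡j) j≤m)
      (λ i+d≡m → trans xi≡xj (cong x (trans (sym i+d≡j) i+d≡m)))
      (λ i+d<m → subst (λ k → Adj H (x i) (x (suc k))) (sym i+d≡j)
                   (subst (λ a → Adj H a (x (suc j))) (sym xi≡xj) (walk j (subst (_< m) i+d≡j i+d<m))))
    where
    i+d≡j : i + (j ∸ i) ≡ j
    i+d≡j = m+[n∸m]≡n (<⇒≤ i<j)
  skip-shortcut {P} m x d {i} {j} i<j j≤m (inj₂ (1+i<j , chord)) =
    shortcut {P} m x d i (j ∸ suc i) (m<n⇒0<n∸m 1+i<j) (≤-trans (<⇒≤ i+d<j) j≤m)
      (λ i+d≡m → ⊥-elim (<-irrefl i+d≡m (<-≤-trans i+d<j j≤m)))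
      (λ _ → subst (λ k → Adj H (x i) (x k)) (sym 1+i+d≡j) chord)
    where
    1+i+d≡j : suc (i + (j ∸ suc i)) ≡ j
    1+i+d≡j = m+[n∸m]≡n (<⇒≤ 1+i<j)
    i+d<j : i + (j ∸ suc i) < j
    i+d<j = ≤-reflexive 1+i+d≡j

  module _ (chordal : Chordal H) {v t₁ t₂ : Fin n} {P : VSet n}
           (v~t₁ : Adj H v t₁) (v~t₂ : Adj H v t₂) (t₁≢t₂ : t₁ ≢ t₂) (t₁≁t₂ : adj H t₁ t₂ ≡ false)
           (P-far : ∀ c → c ∈ P → c ≢ v × adj H v c ≡ false) where

    -- A detour without skips, closed up through v, is an induced cycle of length m + 2.
    module ClosedUp (m : ℕ) (x : ℕ → Fin n) (x0 : x 0 ≡ t₁) (xm : x m ≡ t₂) (walk : IsWalk m x)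
                    (inner : ∀ i → 0 < i → i < m → x i ∈ P)
                    (skip-free : ∀ {i j} → i < j → j ≤ m → ¬ Skip x i j) where

      position : ∀ a → a ≤ m → a ≡ 0 ⊎ a ≡ m ⊎ (0 < a × a < m)
      position zero _ = inj₁ refl
      position (suc a) a≤m with m≤n⇒m<n∨m≡n a≤m
      ... | inj₁ a<m = inj₂ (inj₂ (s≤s z≤n , a<m))
      ... | inj₂ a≡m = inj₂ (inj₁ a≡m)

      x≢v : ∀ a → a ≤ m → x a ≢ v
      x≢v a a≤m e with position a a≤m
      ... | inj₁ refl = Adj-irrefl (sym (trans (sym x0) e)) v~t₁
      ... | inj₂ (inj₁ refl) = Adj-irrefl (sym (trans (sym xm) e)) v~t₂
      ... | inj₂ (inj₂ (0<a , a<m)) = proj₁ (P-far _ (inner a 0<a a<m)) e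

      v~x⇒end : ∀ a → a ≤ m → Adj H v (x a) → a ≡ 0 ⊎ a ≡ m
      v~x⇒end a a≤m e with position a a≤m
      ... | inj₁ a≡0 = inj₁ a≡0
      ... | inj₂ (inj₁ a≡m) = inj₂ a≡m
      ... | inj₂ (inj₂ (0<a , a<m)) = ⊥-elim (not-¬ e (proj₂ (P-far _ (inner a 0<a a<m))))

      x-injective : ∀ a b → a ≤ m → b ≤ m → x a ≡ x b → a ≡ b
      x-injective a b a≤m b≤m e with <-cmp a b
      ... | tri< a<b _ _ = ⊥-elim (skip-free a<b b≤m (inj₁ e))
      ... | tri≈ _ a≡b _ = a≡b
      ... | tri> _ _ b<a = ⊥-elim (skip-free b<a a≤m (inj₁ (sym e)))

      x-adjacent : ∀ a b → a ≤ m → b ≤ m → Adj H (x a) (x b) → suc a ≡ b ⊎ suc b ≡ a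
      x-adjacent a b a≤m b≤m e with <-cmp a b
      ... | tri≈ _ refl _ = ⊥-elim (Adj-irrefl refl e)
      ... | tri< a<b _ _ with suc a ≟ b
      ...   | yes 1+a≡b = inj₁ 1+a≡b
      ...   | no 1+a≢b = ⊥-elim (skip-free a<b b≤m (inj₂ (≤∧≢⇒< a<b 1+a≢b , e)))
      x-adjacent a b a≤m b≤m e | tri> _ _ b<a with suc b ≟ a
      ...   | yes 1+b≡a = inj₂ 1+b≡a
      ...   | no 1+b≢a = ⊥-elim (skip-free b<a a≤m (inj₂ (≤∧≢⇒< b<a 1+b≢a , Adj-sym e)))

      round : ℕ → Fin n
      round = splice m x (λ _ → v)

      round≡x : ∀ {a} → a ≤ m → round a ≡ x a
      round≡x = splice-≤ x (λ _ → v)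

      round≡v : round (suc m) ≡ v
      round≡v = splice-> {i = m} x (λ _ → v) ≤-refl

      last-or-not : ∀ a → a ≤ suc m → a ≤ m ⊎ a ≡ suc m
      last-or-not a a≤1+m with m≤n⇒m<n∨m≡n a≤1+m
      ... | inj₁ a<1+m = inj₁ (s≤s⁻¹ a<1+m)
      ... | inj₂ a≡1+m = inj₂ a≡1+m

      round-injective : ∀ a b → a ≤ suc m → b ≤ suc m → round a ≡ round b → a ≡ b
      round-injective a b a≤ b≤ e with last-or-not a a≤ | last-or-not b b≤
      ... | inj₁ a≤m | inj₁ b≤m = x-injective a b a≤m b≤m (trans (sym (round≡x a≤m)) (trans e (round≡x b≤m)))
      ... | inj₁ a≤m | inj₂ refl = ⊥-elim (x≢v a a≤m (trans (sym (round≡x a≤m)) (trans e round≡v)))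
      ... | inj₂ refl | inj₁ b≤m = ⊥-elim (x≢v b b≤m (trans (sym (round≡x b≤m)) (trans (sym e) round≡v)))
      ... | inj₂ refl | inj₂ refl = refl

      Next : ℕ → ℕ → Set
      Next a b = (suc a ≡ b) ⊎ ((suc a ≡ suc (suc m)) × (b ≡ 0))

      round-adjacent : ∀ a b → a ≤ suc m → b ≤ suc m → Adj H (round a) (round b) → Next a b ⊎ Next b a
      round-adjacent a b a≤ b≤ e with last-or-not a a≤ | last-or-not b b≤
      ... | inj₁ a≤m | inj₁ b≤m with x-adjacent a b a≤m b≤m (subst₂ (Adj H) (round≡x a≤m) (round≡x b≤m) e)
      ...   | inj₁ 1+a≡b = inj₁ (inj₁ 1+a≡b)
      ...   | inj₂ 1+b≡a = inj₂ (inj₁ 1+b≡a)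
      round-adjacent a b a≤ b≤ e | inj₁ a≤m | inj₂ refl with v~x⇒end a a≤m (Adj-sym (subst₂ (Adj H) (round≡x a≤m) round≡v e))
      ...   | inj₁ refl = inj₂ (inj₂ (refl , refl))
      ...   | inj₂ refl = inj₁ (inj₁ refl)
      round-adjacent a b a≤ b≤ e | inj₂ refl | inj₁ b≤m with v~x⇒end b b≤m (subst₂ (Adj H) round≡v (round≡x b≤m) e)
      ...   | inj₁ refl = inj₁ (inj₂ (refl , refl))
      ...   | inj₂ refl = inj₂ (inj₁ refl)
      round-adjacent a b a≤ b≤ e | inj₂ refl | inj₂ refl = ⊥-elim (Adj-irrefl refl e)

      Next⇒round-adjacent : ∀ a b → a ≤ suc m → b ≤ suc m → Next a b → Adj H (round a) (round b)
      Next⇒round-adjacent a b a≤ b≤ (inj₁ refl) with last-or-not b b≤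
      ... | inj₁ b≤m = subst₂ (Adj H) (sym (round≡x (<⇒≤ b≤m))) (sym (round≡x b≤m)) (walk a b≤m)
      ... | inj₂ refl = subst₂ (Adj H) (sym (trans (round≡x ≤-refl) xm)) (sym round≡v) (Adj-sym v~t₂)
      Next⇒round-adjacent a b a≤ b≤ (inj₂ (refl , refl)) = subst₂ (Adj H) (sym round≡v) (sym (trans (round≡x z≤n) x0)) v~t₁

      cycle : Fin (suc (suc m)) → Fin n
      cycle j = round (toℕ j)

      bound : ∀ (j : Fin (suc (suc m))) → toℕ j ≤ suc m
      bound j = s≤s⁻¹ (toℕ<n j)

      cycle-induced : InducedCycle H cycle
      cycle-induced =
        (λ {i} {j} e → toℕ-injective (round-injective (toℕ i) (toℕ j) (bound i) (bound j) e)) ,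
        λ i j → round-adjacent (toℕ i) (toℕ j) (bound i) (bound j) ,
                λ { (inj₁ i→j) → Next⇒round-adjacent (toℕ i) (toℕ j) (bound i) (bound j) i→j
                  ; (inj₂ j→i) → Adj-sym (Next⇒round-adjacent (toℕ j) (toℕ i) (bound j) (bound i) j→i) }

    -- A shortest detour has no skips, so it closes up to an induced cycle of length at least 4.
    no-detour : ∀ m x → ¬ IsDetour P t₁ t₂ m x
    no-detour = <-rec (λ m → ∀ x → ¬ IsDetour P t₁ t₂ m x) shorten
      where
      shorten : ∀ m → (∀ {m′} → m′ < m → ∀ x → ¬ IsDetour P t₁ t₂ m′ x) → ∀ x → ¬ IsDetour P t₁ t₂ m x
      shorten m shorter x d
        with anyUpTo? (λ j → anyUpTo? (λ i → skip? x i j) j) (suc m)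
      ... | yes (j , j<1+m , i , i<j , s) with skip-shortcut {P} m x d i<j (s≤s⁻¹ j<1+m) s
      ...   | m′ , m′<m , y , d′ = shorter m′<m y d′
      shorten zero _ x (x0 , xm , _) | no _ = t₁≢t₂ (trans (sym x0) xm)
      shorten (suc zero) _ x (x0 , xm , walk , _) | no _ =
        not-¬ (walk 0 (s≤s z≤n)) (subst₂ (λ a b → adj H a b ≡ false) (sym x0) (sym xm) t₁≁t₂)
      shorten (suc (suc m)) _ x (x0 , xm , walk , inner) | no no-skip =
        chordal (suc (suc (suc (suc m)))) (s≤s (s≤s (s≤s (s≤s z≤n)))) cycle cycle-induced
        where open ClosedUp (suc (suc m)) x x0 xm walk inner (λ {i} {j} i<j j≤m s → no-skip (j , s≤s j≤m , i , i<j , s))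

  IsWalkIn : VSet n → Fin n → Fin n → ℕ → (ℕ → Fin n) → Set
  IsWalkIn Q a b m x = x 0 ≡ a × x m ≡ b × IsWalk m x × (∀ i → i ≤ m → x i ∈ Q)

  WalkIn : VSet n → Fin n → Fin n → Set
  WalkIn Q a b = ∃ λ m → ∃ (IsWalkIn Q a b m)

  walk-[] : ∀ {Q a} → a ∈ Q → WalkIn Q a a
  walk-[] {a = a} a∈Q = 0 , (λ _ → a) , refl , refl , (λ _ ()) , λ _ _ → a∈Q

  walk-mono : ∀ {Q Q′ a b} → Q ⊆ Q′ → WalkIn Q a b → WalkIn Q′ a b
  walk-mono Q⊆Q′ (m , x , x0 , xm , walk , within) = m , x , x0 , xm , walk , λ i i≤m → Q⊆Q′ _ (within i i≤m)

  walk-reverse : ∀ {Q a b} → WalkIn Q a b → WalkIn Q b a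
  walk-reverse (m , x , x0 , xm , walk , within) =
    m , (λ k → x (m ∸ k)) , xm , trans (cong x (n∸n≡0 m)) x0 , reversed , λ k _ → within (m ∸ k) (m∸n≤m m k)
    where
    reversed : IsWalk m (λ k → x (m ∸ k))
    reversed k k<m = subst (λ i → Adj H (x i) (x (m ∸ suc k))) (sym m∸k≡1+m∸[1+k])
                       (Adj-sym (walk (m ∸ suc k) (subst (_≤ m) m∸k≡1+m∸[1+k] (m∸n≤m m k))))
      where
      m∸k≡1+m∸[1+k] : m ∸ k ≡ suc (m ∸ suc k)
      m∸k≡1+m∸[1+k] = +-∸-assoc 1 k<m

  walk-++ : ∀ {Q a b c} → WalkIn Q a b → WalkIn Q b c → WalkIn Q a c
  walk-++ {Q} {c = c} (m₁ , x , x0 , xm , walk₁ , within₁) (m₂ , y , y0 , ym , walk₂ , within₂) =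
    m₁ + m₂ , z , trans (splice-≤ {i = m₁} x y′ z≤n) x0 , z-end , z-walk , z-within
    where
    y′ : ℕ → Fin n
    y′ k = y (k ∸ m₁)
    z : ℕ → Fin n
    z = splice m₁ x y′
    z≥ : ∀ {k} → m₁ ≤ k → z k ≡ y (k ∸ m₁)
    z≥ {k} m₁≤k with m≤n⇒m<n∨m≡n m₁≤k
    ... | inj₁ m₁<k = splice-> x y′ m₁<k
    ... | inj₂ refl = trans (splice-≤ x y′ ≤-refl) (trans xm (trans (sym y0) (cong y (sym (n∸n≡0 k)))))
    k∸m₁≤ : ∀ {k} → m₁ ≤ k → k ≤ m₁ + m₂ → k ∸ m₁ ≤ m₂
    k∸m₁≤ {k} m₁≤k k≤ = +-cancelˡ-≤ m₁ _ _ (subst (_≤ m₁ + m₂) (sym (m+[n∸m]≡n m₁≤k)) k≤)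
    z-end : z (m₁ + m₂) ≡ c
    z-end = trans (z≥ (m≤m+n m₁ m₂)) (trans (cong y (m+n∸m≡n m₁ m₂)) ym)
    z-walk : IsWalk (m₁ + m₂) z
    z-walk k k<m with m₁ ≤? k
    ... | no k≱m₁ = subst₂ (Adj H) (sym (splice-≤ x y′ (<⇒≤ k<m₁))) (sym (splice-≤ x y′ k<m₁)) (walk₁ k k<m₁)
      where
      k<m₁ : k < m₁
      k<m₁ = ≰⇒> k≱m₁
    ... | yes m₁≤k = subst₂ (Adj H) (sym (z≥ m₁≤k)) (sym (trans (z≥ (m≤n⇒m≤1+n m₁≤k)) (cong y 1+k∸m₁)))
                       (walk₂ (k ∸ m₁) (subst (_≤ m₂) 1+k∸m₁ (k∸m₁≤ (m≤n⇒m≤1+n m₁≤k) k<m)))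
      where
      1+k∸m₁ : suc k ∸ m₁ ≡ suc (k ∸ m₁)
      1+k∸m₁ = +-∸-assoc 1 m₁≤k
    z-within : ∀ k → k ≤ m₁ + m₂ → z k ∈ Q
    z-within k k≤m with m₁ ≤? k
    ... | no k≱m₁ = trans (cong Q (splice-≤ x y′ (<⇒≤ (≰⇒> k≱m₁)))) (within₁ k (<⇒≤ (≰⇒> k≱m₁)))
    ... | yes m₁≤k = trans (cong Q (z≥ m₁≤k)) (within₂ (k ∸ m₁) (k∸m₁≤ m₁≤k k≤m))

  walk-∷ʳ : ∀ {Q a b c} → WalkIn Q a b → Adj H b c → c ∈ Q → WalkIn Q a c
  walk-∷ʳ {Q} {b = b} {c} w@(m , x , _ , xm , _ , within) b~c c∈Q = walk-++ {Q} w (1 , y , refl , refl , step , y-within)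
    where
    y : ℕ → Fin n
    y zero = b
    y (suc _) = c
    step : IsWalk 1 y
    step zero _ = b~c
    step (suc _) (s≤s ())
    y-within : ∀ i → i ≤ 1 → y i ∈ Q
    y-within zero _ = trans (cong Q (sym xm)) (within m ≤-refl)
    y-within (suc zero) _ = c∈Q
    y-within (suc (suc _)) (s≤s ())

  walk⇒detour : ∀ {Q c₁ c₂ t₁ t₂} → WalkIn Q c₁ c₂ → Adj H t₁ c₁ → Adj H c₂ t₂ → ∃₂ (IsDetour Q t₁ t₂)
  walk⇒detour {Q} {t₁ = t₁} {t₂} (m , x , x0 , xm , walk , within) t₁~c₁ c₂~t₂ =
    suc (suc m) , y , refl , splice-> x end ≤-refl , y-walk , y-inner
    where
    end : ℕ → Fin n
    end _ = t₂
    y : ℕ → Fin n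
    y zero = t₁
    y (suc k) = splice m x end k
    y-walk : IsWalk (suc (suc m)) y
    y-walk zero _ = subst (Adj H t₁) (sym (trans (splice-≤ {i = m} x end z≤n) x0)) t₁~c₁
    y-walk (suc k) (s≤s k<1+m) with m≤n⇒m<n∨m≡n (s≤s⁻¹ k<1+m)
    ... | inj₁ k<m = subst₂ (Adj H) (sym (splice-≤ x end (<⇒≤ k<m))) (sym (splice-≤ x end k<m)) (walk k k<m)
    ... | inj₂ refl = subst₂ (Adj H) (sym (trans (splice-≤ x end ≤-refl) xm)) (sym (splice-> x end ≤-refl)) c₂~t₂
    y-inner : ∀ i → 0 < i → i < suc (suc m) → y i ∈ Q
    y-inner (suc k) _ (s≤s k<1+m) = trans (cong Q (splice-≤ x end (s≤s⁻¹ k<1+m))) (within k (s≤s⁻¹ k<1+m))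

-- Perfect elimination orders

-- Each vertex is simplicial among the vertices up to it: pos reverses an elimination ordering.
PerfectEliminationOrder : ∀ {n} → Graph n → (Fin n → ℕ) → Set
PerfectEliminationOrder H pos =
    (∀ u w → pos u ≡ pos w → u ≡ w)
  × (∀ x y z → Adj H x y → Adj H x z → pos y < pos x → pos z < pos x → y ≢ z → Adj H y z)

module _ {n : ℕ} (H : Graph n) where

  Simplicial : VSet n → Fin n → Set
  Simplicial S s = ∀ y z → y ∈ S → z ∈ S → Adj H s y → Adj H s z → y ≢ z → Adj H y z

  CliqueSet : VSet n → Set
  CliqueSet S = ∀ y z → y ∈ S → z ∈ S → y ≢ z → Adj H y z

  NonEdge : VSet n → Fin n → Fin n → Set
  NonEdge S v w = v ∈ S × w ∈ S × w ≢ v × adj H v w ≡ false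

  SimplicialAwayFrom : VSet n → Fin n → Set
  SimplicialAwayFrom S v = ∃ λ s → s ∈ S × Simplicial S s × s ≢ v × adj H v s ≡ false

  clique-or-non-edge : ∀ S → CliqueSet S ⊎ ∃₂ (NonEdge S)
  clique-or-non-edge S
    with any? (λ v → any? (λ w → (S v ≟ᵇ true) ×-dec (S w ≟ᵇ true) ×-dec ¬? (w ≟ᶠ v) ×-dec (adj H v w ≟ᵇ false)))
  ... | yes (v , w , non-edge) = inj₂ (v , w , non-edge)
  ... | no none = inj₁ λ y z y∈S z∈S y≢z → ¬-not λ y≁z → none (y , z , y∈S , z∈S , (λ z≡y → y≢z (sym z≡y)) , y≁z)

  EliminationOrder : VSet n → (Fin n → ℕ) → Set
  EliminationOrder S pos =
      (∀ u w → u ∈ S → w ∈ S → pos u ≡ pos w → u ≡ w)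
    × (∀ u → u ∈ S → pos u < count S)
    × (∀ x y z → x ∈ S → y ∈ S → z ∈ S → Adj H x y → Adj H x z →
         pos y < pos x → pos z < pos x → y ≢ z → Adj H y z)

  elimination-order-snoc : ∀ {S s pos₀} → s ∈ S → Simplicial S s → EliminationOrder (S ∩ ∁ ⁅ s ⁆) pos₀ →
                           ∃ (EliminationOrder S)
  elimination-order-snoc {S} {s} {pos₀} s∈S simp (pos₀-injective , pos₀-bound , pos₀-cliques) =
    pos , pos-injective , pos-bound , pos-cliques
    where
    S₀ : VSet n
    S₀ = S ∩ ∁ ⁅ s ⁆
    S₀-intro : ∀ {u} → u ∈ S → u ≢ s → u ∈ S₀
    S₀-intro u∈S u≢s = ∧-intro u∈S (cong not (x∉⁅y⁆ u≢s))
    pos : Fin n → ℕ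
    pos u with u ≟ᶠ s
    ... | yes _ = count S₀
    ... | no _ = pos₀ u
    pos-s : pos s ≡ count S₀
    pos-s with s ≟ᶠ s
    ... | yes _ = refl
    ... | no s≢s = ⊥-elim (s≢s refl)
    pos-other : ∀ {u} → u ≢ s → pos u ≡ pos₀ u
    pos-other {u} u≢s with u ≟ᶠ s
    ... | yes u≡s = ⊥-elim (u≢s u≡s)
    ... | no _ = refl
    pos≤ : ∀ u → u ∈ S → pos u ≤ count S₀
    pos≤ u u∈S with u ≟ᶠ s
    ... | yes _ = ≤-refl
    ... | no u≢s = <⇒≤ (pos₀-bound u (S₀-intro u∈S u≢s))
    pos-bound : ∀ u → u ∈ S → pos u < count S
    pos-bound u u∈S = subst (pos u <_) (sym (count-remove {p = S} s∈S)) (s≤s (pos≤ u u∈S))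
    pos-injective : ∀ u w → u ∈ S → w ∈ S → pos u ≡ pos w → u ≡ w
    pos-injective u w u∈S w∈S e = by-cases (u ≟ᶠ s) (w ≟ᶠ s)
      where
      by-cases : Dec (u ≡ s) → Dec (w ≡ s) → u ≡ w
      by-cases (yes u≡s) (yes w≡s) = trans u≡s (sym w≡s)
      by-cases (yes u≡s) (no w≢s) =
        ⊥-elim (<-irrefl (trans (sym (pos-other w≢s)) (trans (sym e) (trans (cong pos u≡s) pos-s)))
                         (pos₀-bound w (S₀-intro w∈S w≢s)))
      by-cases (no u≢s) (yes w≡s) =
        ⊥-elim (<-irrefl (trans (sym (pos-other u≢s)) (trans e (trans (cong pos w≡s) pos-s)))
                         (pos₀-bound u (S₀-intro u∈S u≢s)))
      by-cases (no u≢s) (no w≢s) = pos₀-injective u w (S₀-intro u∈S u≢s) (S₀-intro w∈S w≢s)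
                                     (trans (sym (pos-other u≢s)) (trans e (pos-other w≢s)))
    earlier⇒≢s : ∀ {x y} → x ∈ S → pos y < pos x → y ≢ s
    earlier⇒≢s {x} x∈S y<x refl = <-irrefl refl (≤-trans (subst (λ p → suc p ≤ pos x) pos-s y<x) (pos≤ x x∈S))
    pos-cliques : ∀ x y z → x ∈ S → y ∈ S → z ∈ S → Adj H x y → Adj H x z →
                  pos y < pos x → pos z < pos x → y ≢ z → Adj H y z
    pos-cliques x y z x∈S y∈S z∈S x~y x~z y<x z<x y≢z = by-cases (x ≟ᶠ s)
      where
      y≢s : y ≢ s
      y≢s = earlier⇒≢s x∈S y<x
      z≢s : z ≢ s
      z≢s = earlier⇒≢s x∈S z<x
      by-cases : Dec (x ≡ s) → Adj H y z
      by-cases (yes refl) = simp y z y∈S z∈S x~y x~z y≢z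
      by-cases (no x≢s) =
        pos₀-cliques x y z (S₀-intro x∈S x≢s) (S₀-intro y∈S y≢s) (S₀-intro z∈S z≢s) x~y x~z
          (subst₂ _<_ (pos-other y≢s) (pos-other x≢s) y<x) (subst₂ _<_ (pos-other z≢s) (pos-other x≢s) z<x) y≢z

  module _ (chordal : Chordal H) where

    -- For a non-edge v w of S, the component C of w in S minus the closed neighbourhood of v,
    -- together with its attachments in N(v), is a smaller set whose simplicial vertices in C
    -- stay simplicial in S; chordality makes the attachments a clique.
    module Separation {S : VSet n} {v w : Fin n} (v∈S : v ∈ S) (w∈S : w ∈ S) (w≢v : w ≢ v) (v≁w : adj H v w ≡ false) where

      Far : VSet n
      Far = S ∩ ∁ ⁅ v ⁆ ∩ ∁ (adj H v)

      far : ∀ {r} → r ∈ S → r ≢ v → adj H v r ≡ false → r ∈ Far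
      far r∈S r≢v v≁r = ∧-intro r∈S (∧-intro (cong not (x∉⁅y⁆ r≢v)) (cong not v≁r))

      Far⊆S : Far ⊆ S
      Far⊆S r e = ∧-elimˡ e

      far-≢ : ∀ {r} → r ∈ Far → r ≢ v
      far-≢ {r} e r≡v = not-¬ (subst (_∈ ⁅ v ⁆) (sym r≡v) (x∈⁅x⁆ v)) (not-elim (∧-elimˡ (∧-elimʳ {S r} e)))

      far-≁ : ∀ {r} → r ∈ Far → adj H v r ≡ false
      far-≁ {r} e = not-elim (∧-elimʳ (∧-elimʳ {S r} e))

      touches : VSet n → VSet n
      touches P r = anyᵇ (P ∩ adj H r)

      grow : VSet n → VSet n
      grow P = P ∪ Far ∩ touches P

      open Closure grow (λ P u → ∨-introˡ)
                   (λ P≗Q u → cong₂ _∨_ (P≗Q u) (cong (Far u ∧_) (anyᵇ-cong (λ c → cong (_∧ adj H u c) (P≗Q c)))))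

      C : VSet n
      C = closure ⁅ w ⁆

      w∈C : w ∈ C
      w∈C = ⊆-iterate (suc n) ⁅ w ⁆ w (x∈⁅x⁆ w)

      iterate⊆Far : ∀ i → iterate i ⁅ w ⁆ ⊆ Far
      iterate⊆Far zero r e = subst (_∈ Far) (sym (x∈⁅y⁆⇒x≡y e)) (far w∈S w≢v v≁w)
      iterate⊆Far (suc i) r e with ∨-elim {iterate i ⁅ w ⁆ r} e
      ... | inj₁ old = iterate⊆Far i r old
      ... | inj₂ new = ∧-elimˡ new

      C⊆Far : C ⊆ Far
      C⊆Far = iterate⊆Far (suc n)

      C-closed : ∀ {c r} → c ∈ C → r ∈ Far → Adj H c r → r ∈ C
      C-closed {c} {r} c∈C r∈Far c~r =
        trans (sym (closure-stable ⁅ w ⁆ r)) (∨-introʳ (∧-intro r∈Far (anyᵇ-intro c (∧-intro c∈C (Adj-sym H c~r)))))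

      grows : ∀ i → iterate i ⁅ w ⁆ ⊆ iterate (suc i) ⁅ w ⁆
      grows i u = ∨-introˡ

      iterate-walk : ∀ i r → r ∈ iterate i ⁅ w ⁆ → WalkIn H (iterate i ⁅ w ⁆) w r
      iterate-walk zero r e = subst (WalkIn H ⁅ w ⁆ w) (sym (x∈⁅y⁆⇒x≡y e)) (walk-[] H {⁅ w ⁆} (x∈⁅x⁆ w))
      iterate-walk (suc i) r e with ∨-elim {iterate i ⁅ w ⁆ r} e
      ... | inj₁ old = walk-mono H (grows i) (iterate-walk i r old)
      ... | inj₂ new with anyᵇ-elim _ (∧-elimʳ {Far r} new)
      ...   | c , c∈∩ = walk-∷ʳ H {iterate (suc i) ⁅ w ⁆} (walk-mono H (grows i) (iterate-walk i c (∧-elimˡ c∈∩)))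
                                  (Adj-sym H (∧-elimʳ {iterate i ⁅ w ⁆ c} c∈∩)) e

      C-walk : ∀ {c} → c ∈ C → WalkIn H C w c
      C-walk {c} = iterate-walk (suc n) c

      Attach : VSet n
      Attach = S ∩ adj H v ∩ touches C

      attached : ∀ {t} → t ∈ Attach → Adj H v t × ∃ λ c → c ∈ C × Adj H t c
      attached {t} t∈A with anyᵇ-elim _ (∧-elimʳ (∧-elimʳ {S t} t∈A))
      ... | c , c∈ = ∧-elimˡ (∧-elimʳ {S t} t∈A) , c , ∧-elimˡ c∈ , ∧-elimʳ {C c} c∈

      C-far : ∀ c → c ∈ C → c ≢ v × adj H v c ≡ false
      C-far c c∈C = far-≢ (C⊆Far c c∈C) , far-≁ (C⊆Far c c∈C)

      Attach-clique : CliqueSet Attach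
      Attach-clique t₁ t₂ t₁∈A t₂∈A t₁≢t₂ with adj H t₁ t₂ in t₁~t₂ | attached t₁∈A | attached t₂∈A
      ... | true | _ | _ = refl
      ... | false | v~t₁ , c₁ , c₁∈C , t₁~c₁ | v~t₂ , c₂ , c₂∈C , t₂~c₂
            with walk⇒detour H {C} (walk-++ H {C} (walk-reverse H {C} (C-walk c₁∈C)) (C-walk c₂∈C)) t₁~c₁ (Adj-sym H t₂~c₂)
      ...   | m , x , detour = ⊥-elim (no-detour H chordal v~t₁ v~t₂ t₁≢t₂ t₁~t₂ C-far m x detour)

      S′ : VSet n
      S′ = C ∪ Attach

      S′-neighbours : ∀ {s y} → s ∈ C → y ∈ S → Adj H s y → y ∈ S′
      S′-neighbours {s} {y} s∈C y∈S s~y = by-cases (y ≟ᶠ v) (adj H v y) refl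
        where
        by-cases : Dec (y ≡ v) → ∀ b → adj H v y ≡ b → y ∈ S′
        by-cases (yes refl) _ _ = ⊥-elim (not-¬ (Adj-sym H s~y) (far-≁ (C⊆Far s s∈C)))
        by-cases (no y≢v) true v~y =
          ∨-introʳ (∧-intro y∈S (∧-intro v~y (anyᵇ-intro s (∧-intro s∈C (Adj-sym H s~y)))))
        by-cases (no y≢v) false v≁y = ∨-introˡ (C-closed s∈C (far y∈S y≢v v≁y) s~y)

      simplicial-lift : ∀ {s} → s ∈ C → Simplicial S′ s → Simplicial S s
      simplicial-lift s∈C simp y z y∈S z∈S s~y s~z =
        simp y z (S′-neighbours s∈C y∈S s~y) (S′-neighbours s∈C z∈S s~z) s~y s~z

      S′⊆S : S′ ⊆ S
      S′⊆S t e with ∨-elim {C t} e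
      ... | inj₁ t∈C = Far⊆S t (C⊆Far t t∈C)
      ... | inj₂ t∈A = ∧-elimˡ t∈A

      v∉S′ : v ∉ S′
      v∉S′ = ¬-not λ v∈S′ → case ∨-elim {C v} v∈S′ of λ where
        (inj₁ v∈C) → far-≢ (C⊆Far v v∈C) refl
        (inj₂ v∈A) → Adj-irrefl H refl (∧-elimˡ (∧-elimʳ {S v} v∈A))

      S′-smaller : suc (count S′) ≤ count S
      S′-smaller = count-strict v S′⊆S v∈S v∉S′

    -- Dirac's lemma, strengthened so that the induction goes through.
    simplicial-away : ∀ k S → count S ≤ k → ∀ {v w} → NonEdge S v w → SimplicialAwayFrom S v
    simplicial-away zero S count≤0 (v∈S , _) = ⊥-elim (<⇒≱ (count-pos {p = S} _ v∈S) count≤0)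
    simplicial-away (suc k) S count≤ {v} {w} (v∈S , w∈S , w≢v , v≁w) = away
      where
      open Separation {S} v∈S w∈S w≢v v≁w
      shrink : count S′ ≤ k
      shrink = s≤s⁻¹ (≤-trans S′-smaller count≤)
      lift : ∀ {s} → s ∈ C → Simplicial S′ s → SimplicialAwayFrom S v
      lift s∈C simp = _ , Far⊆S _ (C⊆Far _ s∈C) , simplicial-lift s∈C simp , C-far _ s∈C
      -- Either S′ is a clique, or two rounds of recursion in S′ reach C:
      -- the second simplicial vertex is not adjacent to the first, so they cannot both lie in the clique Attach.
      away : SimplicialAwayFrom S v
      away with clique-or-non-edge S′
      ... | inj₁ clique = lift w∈C (λ y z y∈ z∈ _ _ y≢z → clique y z y∈ z∈ y≢z)
      ... | inj₂ (u , x , non-edge@(u∈S′ , _)) with simplicial-away k S′ shrink non-edge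
      ...   | s₁ , s₁∈S′ , simp₁ , s₁≢u , u≁s₁ with ∨-elim {C s₁} s₁∈S′
      ...     | inj₁ s₁∈C = lift s₁∈C simp₁
      ...     | inj₂ s₁∈A with simplicial-away k S′ shrink (s₁∈S′ , u∈S′ , ≢-sym s₁≢u , trans (symmetric H s₁ u) u≁s₁)
      ...       | s₂ , s₂∈S′ , simp₂ , s₂≢s₁ , s₁≁s₂ with ∨-elim {C s₂} s₂∈S′
      ...         | inj₁ s₂∈C = lift s₂∈C simp₂
      ...         | inj₂ s₂∈A = ⊥-elim (not-¬ (Attach-clique s₁ s₂ s₁∈A s₂∈A (≢-sym s₂≢s₁)) s₁≁s₂)

    simplicial-exists : ∀ S x → x ∈ S → ∃ λ s → s ∈ S × Simplicial S s
    simplicial-exists S x x∈S with clique-or-non-edge S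
    ... | inj₁ clique = x , x∈S , λ y z y∈S z∈S _ _ → clique y z y∈S z∈S
    ... | inj₂ (v , w , non-edge) with simplicial-away (count S) S ≤-refl non-edge
    ...   | s , s∈S , simp , _ = s , s∈S , simp

    elimination-order : ∀ k S → count S ≤ k → ∃ (EliminationOrder S)
    elimination-order k S count≤k with any? (λ u → S u ≟ᵇ true)
    ... | no empty = (λ _ → 0) , (λ u _ u∈S → ⊥-elim (empty (u , u∈S))) , (λ u u∈S → ⊥-elim (empty (u , u∈S))) ,
                     λ x _ _ x∈S → ⊥-elim (empty (x , x∈S))
    elimination-order zero S count≤0 | yes (x , x∈S) = ⊥-elim (<⇒≱ (count-pos {p = S} x x∈S) count≤0)
    elimination-order (suc k) S count≤ | yes (x , x∈S) with simplicial-exists S x x∈S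
    ... | s , s∈S , simp =
          elimination-order-snoc s∈S simp
            (proj₂ (elimination-order k (S ∩ ∁ ⁅ s ⁆) (s≤s⁻¹ (subst (_≤ suc k) (count-remove {p = S} s∈S) count≤))))

    perfect-elimination-order : ∃ (PerfectEliminationOrder H)
    perfect-elimination-order with elimination-order n (λ _ → true) (count≤n _)
    ... | pos , injective , _ , cliques =
      pos , (λ u w → injective u w refl refl) , (λ x y z → cliques x y z refl refl refl)

module _ {n : ℕ} (H : Graph n) (pos : Fin n → ℕ) where

  earlier : Fin n → VSet n
  earlier v u = adj H v u ∧ does (pos u <? pos v)

  later : Fin n → VSet n
  later v u = adj H v u ∧ does (pos v <? pos u)

  -- A vertex together with its earlier neighbours is a clique.
  earlier-degree : PerfectEliminationOrder H pos → ∀ {l} → ¬ HasClique H (suc (suc l)) → ∀ v → count (earlier v) ≤ l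
  earlier-degree (pos-injective , cliques) {l} no-clique v with count (earlier v) ≤? l
  ... | yes ≤l = ≤l
  ... | no ≰l = ⊥-elim (no-clique (clique , clique-injective , clique-adjacent))
    where
    l<count : suc l ≤ count (earlier v)
    l<count = ≰⇒> ≰l
    listed : Fin (count (earlier v)) → Fin n
    listed = proj₁ (enumerate (earlier v))
    nbr : Fin (suc l) → Fin n
    nbr i = listed (inject≤ i l<count)
    nbr-earlier : ∀ i → nbr i ∈ earlier v
    nbr-earlier i = proj₂ (proj₂ (enumerate (earlier v))) (inject≤ i l<count)
    v~nbr : ∀ i → Adj H v (nbr i)
    v~nbr i = ∧-elimˡ (nbr-earlier i)
    nbr<v : ∀ i → pos (nbr i) < pos v
    nbr<v i = does-witness (pos (nbr i) <? pos v) (∧-elimʳ {adj H v (nbr i)} (nbr-earlier i))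
    nbr-injective : ∀ {i j} → nbr i ≡ nbr j → i ≡ j
    nbr-injective {i} {j} e = inject≤-injective l<count l<count i j (proj₁ (proj₂ (enumerate (earlier v))) e)
    nbr≢v : ∀ i → nbr i ≢ v
    nbr≢v i e = Adj-irrefl H (sym e) (v~nbr i)
    clique : Fin (suc (suc l)) → Fin n
    clique zero = v
    clique (suc i) = nbr i
    clique-injective : Injective _≡_ _≡_ clique
    clique-injective {zero} {zero} _ = refl
    clique-injective {zero} {suc j} e = ⊥-elim (nbr≢v j (sym e))
    clique-injective {suc i} {zero} e = ⊥-elim (nbr≢v i e)
    clique-injective {suc i} {suc j} e = cong suc (nbr-injective e)
    clique-adjacent : ∀ i j → i ≢ j → Adj H (clique i) (clique j)
    clique-adjacent zero zero i≢j = ⊥-elim (i≢j refl)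
    clique-adjacent zero (suc j) _ = v~nbr j
    clique-adjacent (suc i) zero _ = Adj-sym H (v~nbr i)
    clique-adjacent (suc i) (suc j) i≢j =
      cliques v (nbr i) (nbr j) (v~nbr i) (v~nbr j) (nbr<v i) (nbr<v j) (λ e → i≢j (cong suc (nbr-injective e)))

-- Colourings and the relaxed game

has-colour : ∀ {c} → Fin c → Maybe (Fin c) → Bool
has-colour a (just b) = ⁅ b ⁆ a
has-colour a nothing = false

module _ {n c : ℕ} where

  update-≡ : ∀ (σ : Colouring n c) v a → update σ v a v ≡ just a
  update-≡ σ v a with v ≟ᶠ v
  ... | yes _ = refl
  ... | no v≢v = ⊥-elim (v≢v refl)

  update-≢ : ∀ (σ : Colouring n c) v a {w} → w ≢ v → update σ v a w ≡ σ w
  update-≢ σ v a {w} w≢v with w ≟ᶠ v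
  ... | yes w≡v = ⊥-elim (w≢v w≡v)
  ... | no _ = refl

  coloured : Colouring n c → VSet n
  coloured σ u = is-just (σ u)

  colour-class : Colouring n c → Fin c → VSet n
  colour-class σ a u = has-colour a (σ u)

  uncoloured : Colouring n c → VSet n
  uncoloured σ = ∁ (coloured σ)

  uncoloured-intro : ∀ σ {u} → σ u ≡ nothing → u ∈ uncoloured σ
  uncoloured-intro σ σu = cong (not ∘ is-just) σu

  uncoloured-elim : ∀ σ {u} → u ∈ uncoloured σ → σ u ≡ nothing
  uncoloured-elim σ {u} e with σ u
  ... | nothing = refl

  uncoloured-or-complete : ∀ σ → (∃ λ z → σ z ≡ nothing) ⊎ Complete σ
  uncoloured-or-complete σ with any? (λ u → uncoloured σ u ≟ᵇ true)
  ... | yes (z , z∈) = inj₁ (z , uncoloured-elim σ z∈)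
  ... | no none = inj₂ λ v → coloured-vertex v (λ e → none (v , uncoloured-intro σ e))
    where
    coloured-vertex : ∀ v → σ v ≢ nothing → ∃ λ a → σ v ≡ just a
    coloured-vertex v σv≢nothing with σ v
    ... | just a = a , refl
    ... | nothing = ⊥-elim (σv≢nothing refl)

  colouring-shrinks : ∀ σ {v} a → σ v ≡ nothing → suc (count (uncoloured (update σ v a))) ≤ count (uncoloured σ)
  colouring-shrinks σ {v} a σv = count-strict v still-uncoloured (uncoloured-intro σ σv) (cong (not ∘ is-just) (update-≡ σ v a))
    where
    still-uncoloured : uncoloured (update σ v a) ⊆ uncoloured σ
    still-uncoloured u e with u ≟ᶠ v
    ... | yes refl = uncoloured-intro σ σv
    ... | no _ = e

  coloured-update : ∀ (σ : Colouring n c) {x} a → coloured σ ⊆ coloured (update σ x a)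
  coloured-update σ {x} a u e with u ≟ᶠ x
  ... | yes _ = refl
  ... | no _ = e

  update-uncoloured : ∀ (σ : Colouring n c) {x a v} → update σ x a v ≡ nothing → v ≢ x × σ v ≡ nothing
  update-uncoloured σ {x} {a} {v} σ′v = v≢x , trans (sym (update-≢ σ x a v≢x)) σ′v
    where
    v≢x : v ≢ x
    v≢x refl with trans (sym σ′v) (update-≡ σ x a)
    ... | ()

  count-coloured-update : ∀ (σ : Colouring n c) {x} a (p : VSet n) → σ x ≡ nothing →
                          count (coloured (update σ x a) ∩ p) ≡ iverson (p x) + count (coloured σ ∩ p)
  count-coloured-update σ {x} a p σx =
    trans (count-split (coloured (update σ x a) ∩ p) (coloured σ ∩ p) x
             (λ u u≢x → cong (λ m → is-just m ∧ p u) (update-≢ σ x a u≢x))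
             (cong (λ m → is-just m ∧ p x) σx))
          (cong (λ m → iverson (is-just m ∧ p x) + count (coloured σ ∩ p)) (update-≡ σ x a))

-- A vertex with fewer than c * k coloured neighbours has a legal colour: by pigeonhole some
-- colour a occurs on fewer than k of them, and a monochromatic (k+1)-clique through the
-- newly coloured vertex would need k neighbours of colour a.
module _ {n c : ℕ} (G : Graph n) (k : ℕ) where

  coloured-neighbours : Colouring n c → Fin n → ℕ
  coloured-neighbours σ v = count (coloured σ ∩ adj G v)

  ∑-colour-classes : ∀ (σ : Colouring n c) v → sum (λ a → count (colour-class σ a ∩ adj G v)) ≤ coloured-neighbours σ v
  ∑-colour-classes σ v = ∑-count≤count (λ a → colour-class σ a ∩ adj G v) (coloured σ ∩ adj G v) per-vertex
    where
    per-vertex : ∀ u → sum (λ a → iverson (has-colour a (σ u) ∧ adj G v u)) ≤ iverson (is-just (σ u) ∧ adj G v u)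
    per-vertex u with σ u
    ... | nothing = ≤-reflexive (count-∅ c)
    ... | just b = ≤-reflexive (count-⁅⁆∩ b (λ _ → adj G v u))

  extend-legal : ∀ {σ : Colouring n c} {v} a → Legal G k σ → σ v ≡ nothing → count (colour-class σ a ∩ adj G v) < k →
                 Legal G k (update σ v a)
  extend-legal {σ} {v} a legal σv few (f , (f-injective , f-adjacent) , col , mono) with any? (λ i → f i ≟ᶠ v)
  ... | no v∉f = legal (f , (f-injective , f-adjacent) , col , λ i → trans (sym (update-≢ σ v a (λ e → v∉f (i , e)))) (mono i))
  ... | yes (i , fi≡v) = <⇒≱ few (count-injection _ others others-injective others-in-class)
    where
    a≡col : a ≡ col
    a≡col = just-injective (trans (sym (update-≡ σ v a)) (trans (cong (update σ v a) (sym fi≡v)) (mono i)))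
    others : Fin k → Fin n
    others j = f (punchIn i j)
    others-injective : Injective _≡_ _≡_ others
    others-injective {x} {y} e = punchIn-injective i x y (f-injective e)
    other≢v : ∀ j → others j ≢ v
    other≢v j e = punchInᵢ≢i i j (f-injective (trans e (sym fi≡v)))
    others-in-class : ∀ j → others j ∈ colour-class σ a ∩ adj G v
    others-in-class j =
      ∧-intro (trans (cong (has-colour a) (trans (sym (update-≢ σ v a (other≢v j)))
                                             (trans (mono (punchIn i j)) (cong just (sym a≡col)))))
                     (x∈⁅x⁆ a))
              (subst (λ w → Adj G w (others j)) fi≡v (f-adjacent i (punchIn i j) (λ e → punchInᵢ≢i i j (sym e))))

  legal-colour : ∀ {σ v} → Legal G k σ → σ v ≡ nothing → coloured-neighbours σ v < c * k →
                 ∃ λ a → Legal G k (update σ v a)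
  legal-colour {σ} {v} legal σv few with any? (λ a → count (colour-class σ a ∩ adj G v) <? k)
  ... | yes (a , rare) = a , extend-legal a legal σv rare
  ... | no none-rare = ⊥-elim (<⇒≱ few (begin
    c * k                                                   ≡⟨ sum-const c k ⟨
    sum {c} (λ _ → k)                                       ≤⟨ sum-mono (λ a → ≮⇒≥ (λ rare → none-rare (a , rare))) ⟩
    sum (λ a → count (colour-class σ a ∩ adj G v))          ≤⟨ ∑-colour-classes σ v ⟩
    coloured-neighbours σ v                                 ∎))
    where open ≤-Reasoning

  not-stuck : ∀ {σ} → Legal G k σ → (∀ v → σ v ≡ nothing → coloured-neighbours σ v < c * k) → ¬ Stuck G k σ
  not-stuck legal few (v , σv , no-colour) with legal-colour legal σv (few v σv)
  ... | a , legal′ = no-colour a legal′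

  module _ (AliceTurn BobTurn : Colouring n c → Set)
           (alice-safe : ∀ {σ} → AliceTurn σ → ¬ Stuck G k σ)
           (alice-move : ∀ {σ z} → AliceTurn σ → σ z ≡ nothing →
                         ∃₂ λ v a → σ v ≡ nothing × Legal G k (update σ v a) × BobTurn (update σ v a))
           (bob-safe : ∀ {σ} → BobTurn σ → ¬ Stuck G k σ)
           (bob-move : ∀ {σ v a} → BobTurn σ → σ v ≡ nothing → Legal G k (update σ v a) → AliceTurn (update σ v a))
           where

    private
      alice-wins-within : ∀ f σ → count (uncoloured σ) ≤ f → AliceTurn σ → AliceWinsA G k σ
      bob-loses-within : ∀ f σ → count (uncoloured σ) ≤ f → BobTurn σ → AliceWinsB G k σ

      alice-wins-within f σ ≤f turn with uncoloured-or-complete σ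
      ... | inj₂ complete = finished complete
      ... | inj₁ (z , σz) with f | alice-move turn σz
      ...   | zero | _ = ⊥-elim (<⇒≱ (count-pos z (uncoloured-intro σ σz)) ≤f)
      ...   | suc f | v , a , σv , legal , bob-turn =
              move (alice-safe turn) v a σv legal
                   (bob-loses-within f _ (s≤s⁻¹ (≤-trans (colouring-shrinks σ a σv) ≤f)) bob-turn)

      bob-loses-within f σ ≤f turn with uncoloured-or-complete σ
      ... | inj₂ complete = finished complete
      ... | inj₁ (z , σz) with f
      ...   | zero = ⊥-elim (<⇒≱ (count-pos z (uncoloured-intro σ σz)) ≤f)
      ...   | suc f = move (bob-safe turn) λ v a σv legal →
              alice-wins-within f _ (s≤s⁻¹ (≤-trans (colouring-shrinks σ a σv) ≤f)) (bob-move turn σv legal)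

    alice-wins-by-invariant : ∀ {σ} → AliceTurn σ → AliceWinsA G k σ
    alice-wins-by-invariant {σ} = alice-wins-within n σ (count≤n _)

-- The activation strategy

module Activation {n c : ℕ} (G H : Graph n) (k l : ℕ) (G⊆H : G ⊆G H) (pos : Fin n → ℕ)
                  (peo : PerfectEliminationOrder H pos) (earlier≤l : ∀ v → count (earlier H pos v) ≤ l)
                  (enough : 3 * l + 2 < c * k) where

  before : Fin n → VSet n
  before = earlier H pos

  after : Fin n → VSet n
  after = later H pos

  BalancedAt : Colouring n c → VSet n → Fin n → ℕ → Set
  BalancedAt σ A v slack =
    count (A ∩ after v) ≤ count (A ∩ before v) + count (coloured σ ∩ before v) + iverson (A v) + slack

  Balanced : Colouring n c → VSet n → (Fin n → ℕ) → Set
  Balanced σ A slack = ∀ v → σ v ≡ nothing → BalancedAt σ A v (slack v)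

  credit : Fin n → Fin n → ℕ
  credit x v = iverson (before v x) + iverson (⁅ v ⁆ x)

  -- Alice's walk is at x: only x may be coloured without being active.
  Walking : Colouring n c → VSet n → Fin n → Set
  Walking σ A x = coloured σ ⊆ A ∪ ⁅ x ⁆ × Balanced σ A (credit x)

  BobTurn : Colouring n c → Set
  BobTurn σ = ∃ λ A → Legal G k σ × coloured σ ⊆ A × Balanced σ A (λ _ → 0)

  AliceTurn : Colouring n c → Set
  AliceTurn σ = ∃₂ λ A b → Legal G k σ × coloured σ ⊆ A ∪ ⁅ b ⁆ × Balanced σ A (λ _ → 0)

  ∩-before≤l : ∀ (p : VSet n) v → count (p ∩ before v) ≤ l
  ∩-before≤l p v = ≤-trans (count-mono (λ u e → ∧-elimʳ {p u} e)) (earlier≤l v)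

  before-or-after : ∀ {u v} → Adj H v u → u ≢ v → u ∈ before v ⊎ u ∈ after v
  before-or-after {u} {v} v~u u≢v with <-cmp (pos u) (pos v)
  ... | tri< u<v _ _ = inj₁ (∧-intro v~u (dec-true (pos u <? pos v) u<v))
  ... | tri≈ _ pu≡pv _ = ⊥-elim (u≢v (proj₁ peo u v pu≡pv))
  ... | tri> _ _ v<u = inj₂ (∧-intro v~u (dec-true (pos v <? pos u) v<u))

  neighbours-split : ∀ (σ : Colouring n c) v →
                     coloured-neighbours G k σ v ≤ count (coloured σ ∩ before v) + count (coloured σ ∩ after v)
  neighbours-split σ v = ≤-trans (count-mono split) (count-∪ (coloured σ ∩ before v) (coloured σ ∩ after v))
    where
    split : coloured σ ∩ adj G v ⊆ (coloured σ ∩ before v) ∪ (coloured σ ∩ after v)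
    split u e with before-or-after (G⊆H v u v~u) (λ u≡v → Adj-irrefl G (sym u≡v) v~u)
      where
      v~u : Adj G v u
      v~u = ∧-elimʳ {coloured σ u} e
    ... | inj₁ u-before = ∨-introˡ (∧-intro (∧-elimˡ {coloured σ u} e) u-before)
    ... | inj₂ u-after = ∨-introʳ {coloured σ u ∧ before v u} (∧-intro (∧-elimˡ {coloured σ u} e) u-after)

  coloured-after≤ : ∀ {σ A b slack v} → coloured σ ⊆ A ∪ ⁅ b ⁆ → Balanced σ A slack → σ v ≡ nothing →
                    iverson (after v b) + slack v ≤ 1 → count (coloured σ ∩ after v) ≤ suc (suc (l + l))
  coloured-after≤ {σ} {A} {b} {slack} {v} col⊆ balanced σv ≤1 = begin
    count (coloured σ ∩ after v)
      ≤⟨ count-mono split ⟩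
    count ((⁅ b ⁆ ∩ after v) ∪ (A ∩ after v))
      ≤⟨ count-∪ (⁅ b ⁆ ∩ after v) (A ∩ after v) ⟩
    count (⁅ b ⁆ ∩ after v) + count (A ∩ after v)
      ≤⟨ +-mono-≤ (≤-reflexive (count-⁅⁆∩ b (after v))) (balanced v σv) ⟩
    iverson (after v b) + (count (A ∩ before v) + count (coloured σ ∩ before v) + iverson (A v) + slack v)
      ≤⟨ +-monoʳ-≤ (iverson (after v b)) (+-monoˡ-≤ (slack v) earlier-terms) ⟩
    iverson (after v b) + (l + l + 1 + slack v)
      ≡⟨ rearrange (iverson (after v b)) l (slack v) ⟩
    (iverson (after v b) + slack v) + suc (l + l)
      ≤⟨ +-monoˡ-≤ (suc (l + l)) ≤1 ⟩
    suc (suc (l + l)) ∎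
    where
    open ≤-Reasoning
    split : coloured σ ∩ after v ⊆ (⁅ b ⁆ ∩ after v) ∪ (A ∩ after v)
    split u e with ∨-elim {A u} (col⊆ u (∧-elimˡ e))
    ... | inj₁ u∈A = ∨-introʳ {⁅ b ⁆ u ∧ after v u} (∧-intro u∈A (∧-elimʳ {coloured σ u} e))
    ... | inj₂ u∈b = ∨-introˡ (∧-intro u∈b (∧-elimʳ {coloured σ u} e))
    earlier-terms : count (A ∩ before v) + count (coloured σ ∩ before v) + iverson (A v) ≤ l + l + 1
    earlier-terms = +-mono-≤ (+-mono-≤ (∩-before≤l A v) (∩-before≤l (coloured σ) v)) (iverson≤1 (A v))
    rearrange : ∀ a l s → a + (l + l + 1 + s) ≡ (a + s) + suc (l + l)
    rearrange = solve-∀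

  few-neighbours : ∀ {σ v} → count (coloured σ ∩ after v) ≤ suc (suc (l + l)) → coloured-neighbours G k σ v < c * k
  few-neighbours {σ} {v} after≤ = begin-strict
    coloured-neighbours G k σ v                                    ≤⟨ neighbours-split σ v ⟩
    count (coloured σ ∩ before v) + count (coloured σ ∩ after v)   ≤⟨ +-mono-≤ (∩-before≤l (coloured σ) v) after≤ ⟩
    l + suc (suc (l + l))                                          ≡⟨ three-l+2 l ⟩
    3 * l + 2                                                      <⟨ enough ⟩
    c * k                                                          ∎
    where
    open ≤-Reasoning
    three-l+2 : ∀ l → l + suc (suc (l + l)) ≡ 3 * l + 2
    three-l+2 = solve-∀

  safe : ∀ {σ} → Legal G k σ → (∀ v → σ v ≡ nothing → count (coloured σ ∩ after v) ≤ suc (suc (l + l))) →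
         ¬ Stuck G k σ
  safe legal after≤ = not-stuck G k legal (λ v σv → few-neighbours (after≤ v σv))

  after-irrefl : ∀ v → after v v ≡ false
  after-irrefl v = cong (_∧ _) (irreflexive H v)

  before-irrefl : ∀ v → before v v ≡ false
  before-irrefl v = cong (_∧ _) (irreflexive H v)

  bob-safe : ∀ {σ} → BobTurn σ → ¬ Stuck G k σ
  bob-safe (A , legal , col⊆ , balanced) =
    safe legal λ v σv → coloured-after≤ (λ u e → ∨-introˡ (col⊆ u e)) balanced σv
                          (≤-trans (≤-reflexive (cong (λ b → iverson b + 0) (after-irrefl v))) z≤n)

  alice-safe : ∀ {σ} → AliceTurn σ → ¬ Stuck G k σ
  alice-safe (A , b , legal , col⊆ , balanced) =
    safe legal λ v σv → coloured-after≤ col⊆ balanced σv (≤-trans (≤-reflexive (+-identityʳ _)) (iverson≤1 _))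

  weaken : ∀ {σ A v s s′} → BalancedAt σ A v s → s ≤ s′ → BalancedAt σ A v s′
  weaken balanced s≤s′ = ≤-trans balanced (+-monoʳ-≤ _ s≤s′)

  -- Activating x adds x to the active later neighbours of v only if x comes after v, which the slack s pays for.
  activate-at : ∀ {σ A x v s} → x ∉ A → BalancedAt σ A v (credit x v) → (x ∈ after v → 1 ≤ s) →
                BalancedAt σ (⁅ x ⁆ ∪ A) v s
  activate-at {σ} {A} {x} {v} {s} x∉A balanced paid = begin
    count ((⁅ x ⁆ ∪ A) ∩ after v)
      ≡⟨ count-insert A (after v) x∉A ⟩
    iverson (after v x) + count (A ∩ after v)
      ≤⟨ +-mono-≤ (iverson≤ paid) balanced ⟩
    s + (count (A ∩ before v) + CB + iverson (A v) + (iverson (before v x) + iverson (⁅ v ⁆ x)))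
      ≡⟨ regroup s (count (A ∩ before v)) CB (iverson (A v)) (iverson (before v x)) _ ⟩
    (iverson (before v x) + count (A ∩ before v)) + CB + (iverson (A v) + iverson (⁅ v ⁆ x)) + s
      ≤⟨ +-monoˡ-≤ s (+-monoʳ-≤ _ (newly-active (v ≟ᶠ x))) ⟩
    (iverson (before v x) + count (A ∩ before v)) + CB + iverson ((⁅ x ⁆ ∪ A) v) + s
      ≡⟨ cong (λ m → m + CB + iverson ((⁅ x ⁆ ∪ A) v) + s) (count-insert A (before v) x∉A) ⟨
    count ((⁅ x ⁆ ∪ A) ∩ before v) + CB + iverson ((⁅ x ⁆ ∪ A) v) + s ∎
    where
    open ≤-Reasoning
    CB : ℕ
    CB = count (coloured σ ∩ before v)
    regroup : ∀ s a b c d e → s + (a + b + c + (d + e)) ≡ (d + a) + b + (c + e) + s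
    regroup = solve-∀
    newly-active : Dec (v ≡ x) → iverson (A v) + iverson (⁅ v ⁆ x) ≤ iverson ((⁅ x ⁆ ∪ A) v)
    newly-active (yes refl) rewrite x∉A | x∈⁅x⁆ v = ≤-refl
    newly-active (no v≢x) rewrite x∉⁅y⁆ v≢x | x∉⁅y⁆ (≢-sym v≢x) = ≤-reflexive (+-identityʳ _)

  candidates : Colouring n c → Fin n → VSet n
  candidates σ x = (⁅ x ⁆ ∪ before x) ∩ uncoloured σ

  earlier-candidate : ∀ {σ x v} → σ v ≡ nothing → x ∈ after v → v ∈ candidates σ x
  earlier-candidate {σ} {x} {v} σv x-after =
    ∧-intro (∨-introʳ (∧-intro (Adj-sym H (∧-elimˡ x-after)) (∧-elimʳ {adj H v x} x-after))) (uncoloured-intro σ σv)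

  -- If x comes after v, the first candidate y is v itself or, by the elimination order, an earlier neighbour of v.
  credit-earned : ∀ {σ x y v} → σ v ≡ nothing → y ∈ candidates σ x → (∀ z → z ∈ candidates σ x → pos y ≤ pos z) →
                  x ∈ after v → 1 ≤ credit y v
  credit-earned {σ} {x} {y} {v} σv y∈ y-min x-after = by-cases (∨-elim {⁅ x ⁆ y} (∧-elimˡ y∈)) (y ≟ᶠ v)
    where
    v<x : pos v < pos x
    v<x = does-witness (pos v <? pos x) (∧-elimʳ {adj H v x} x-after)
    y≤v : pos y ≤ pos v
    y≤v = y-min v (earlier-candidate {σ} σv x-after)
    by-cases : y ∈ ⁅ x ⁆ ⊎ y ∈ before x → Dec (y ≡ v) → 1 ≤ credit y v
    by-cases (inj₁ y≡x) _ = ⊥-elim (<⇒≱ v<x (subst (λ w → pos w ≤ pos v) (x∈⁅y⁆⇒x≡y y≡x) y≤v))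
    by-cases (inj₂ _) (yes refl) rewrite x∈⁅x⁆ y = m≤n+m 1 _
    by-cases (inj₂ y-before) (no y≢v) = ≤-trans (≤-reflexive (cong iverson (sym y-before-v))) (m≤m+n _ _)
      where
      y<v : pos y < pos v
      y<v = ≤∧≢⇒< y≤v (λ e → y≢v (proj₁ peo y v e))
      y~v : Adj H y v
      y~v = proj₂ peo x y v (∧-elimˡ y-before) (Adj-sym H (∧-elimˡ x-after))
              (does-witness (pos y <? pos x) (∧-elimʳ {adj H x y} y-before)) v<x y≢v
      y-before-v : before v y ≡ true
      y-before-v = ∧-intro (Adj-sym H y~v) (dec-true (pos y <? pos v) y<v)

  moved : ∀ {σ : Colouring n c} {A x y} → coloured σ ⊆ A ∪ ⁅ x ⁆ → coloured σ ⊆ (⁅ x ⁆ ∪ A) ∪ ⁅ y ⁆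
  moved {A = A} {x} col⊆ u e with ∨-elim {A u} (col⊆ u e)
  ... | inj₁ u∈A = ∨-introˡ (∨-introʳ {⁅ x ⁆ u} u∈A)
  ... | inj₂ u∈x = ∨-introˡ (∨-introˡ u∈x)

  walk-step : ∀ {σ A x z} → Walking σ A x → x ∉ A → σ z ≡ nothing →
              ∃ λ y → σ y ≡ nothing × Walking σ (⁅ x ⁆ ∪ A) y
  walk-step {σ} {A} {x} {z} (col⊆ , balanced) x∉A σz with argmin pos (candidates σ x)
  ... | inj₁ (y , y∈ , y-min) =
        y , uncoloured-elim σ (∧-elimʳ {(⁅ x ⁆ ∪ before x) y} y∈) , moved {σ} col⊆ ,
        λ v σv → activate-at {σ} x∉A (balanced v σv) (credit-earned σv y∈ y-min)
  ... | inj₂ none =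
        z , σz , moved {σ} col⊆ ,
        λ v σv → activate-at {σ} x∉A (balanced v σv) (λ x-after → ⊥-elim (not-¬ (earlier-candidate {σ} σv x-after) (none v)))

  walk-to-active : ∀ f {σ A x} → count (∁ A) ≤ f → Walking σ A x → σ x ≡ nothing →
                   ∃₂ λ A′ x′ → σ x′ ≡ nothing × x′ ∈ A′ × Walking σ A′ x′
  walk-to-active f {σ} {A} {x} ≤f walking σx with A x in x∈A?
  ... | true = A , x , σx , x∈A? , walking
  ... | false with f
  ...   | zero = ⊥-elim (<⇒≱ (count-pos x (cong not x∈A?)) ≤f)
  ...   | suc f with walk-step walking x∈A? σx
  ...     | y , σy , walking′ =
            walk-to-active f (s≤s⁻¹ (≤-trans (count-strict x (∁-antitone (λ u → ∨-introʳ)) (cong not x∈A?) x-active) ≤f))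
              walking′ σy
    where
    x-active : x ∉ ∁ (⁅ x ⁆ ∪ A)
    x-active = cong (λ b → not (b ∨ A x)) (x∈⁅x⁆ x)

  -- Colouring x turns the credit x v of each remaining vertex v into a coloured earlier neighbour.
  colouring-rebalances : ∀ {σ A x} a → σ x ≡ nothing → Balanced σ A (credit x) → Balanced (update σ x a) A (λ _ → 0)
  colouring-rebalances {σ} {A} {x} a σx balanced v σ′v = begin
    count (A ∩ after v)
      ≤⟨ balanced v σv ⟩
    active + coloured-before + iverson (A v) + (iverson (before v x) + iverson (⁅ v ⁆ x))
      ≡⟨ cong (λ b → active + coloured-before + iverson (A v) + (iverson (before v x) + iverson b)) (x∉⁅y⁆ (≢-sym v≢x)) ⟩
    active + coloured-before + iverson (A v) + (iverson (before v x) + 0)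
      ≡⟨ regroup active coloured-before (iverson (A v)) (iverson (before v x)) ⟩
    active + (iverson (before v x) + coloured-before) + iverson (A v) + 0
      ≡⟨ cong (λ m → active + m + iverson (A v) + 0) (count-coloured-update σ a (before v) σx) ⟨
    active + count (coloured (update σ x a) ∩ before v) + iverson (A v) + 0 ∎
    where
    open ≤-Reasoning
    v≢x : v ≢ x
    v≢x = proj₁ (update-uncoloured σ {x} {a} σ′v)
    σv : σ v ≡ nothing
    σv = proj₂ (update-uncoloured σ {x} {a} σ′v)
    active coloured-before : ℕ
    active = count (A ∩ before v)
    coloured-before = count (coloured σ ∩ before v)
    regroup : ∀ a b c d → a + b + c + (d + 0) ≡ a + (d + b) + c + 0
    regroup = solve-∀

  colouring-active : ∀ {σ : Colouring n c} {A x} a → x ∈ A → coloured σ ⊆ A ∪ ⁅ x ⁆ → coloured (update σ x a) ⊆ A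
  colouring-active {σ} {A} {x} a x∈A col⊆ u e with u ≟ᶠ x
  ... | yes refl = x∈A
  ... | no u≢x with ∨-elim {A u} (col⊆ u e)
  ...   | inj₁ u∈A = u∈A
  ...   | inj₂ u∈x = ⊥-elim (u≢x (x∈⁅y⁆⇒x≡y u∈x))

  colour-active : ∀ {σ A x} → Legal G k σ → σ x ≡ nothing → x ∈ A → Walking σ A x →
                  ∃ λ a → Legal G k (update σ x a) × BobTurn (update σ x a)
  colour-active {σ} {A} {x} legal σx x∈A (col⊆ , balanced)
    with legal-colour G k legal σx (few-neighbours (coloured-after≤ {σ} col⊆ balanced σx last-slack))
    where
    last-slack : iverson (after x x) + credit x x ≤ 1
    last-slack rewrite after-irrefl x | x∈⁅x⁆ x = ≤-refl
  ... | a , legal′ = a , legal′ , A , legal′ , colouring-active a x∈A col⊆ , colouring-rebalances a σx balanced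

  bob-move : ∀ {σ v a} → BobTurn σ → σ v ≡ nothing → Legal G k (update σ v a) → AliceTurn (update σ v a)
  bob-move {σ} {v} {a} (A , _ , col⊆ , balanced) σv legal′ = A , v , legal′ , col⊆′ , balanced′
    where
    col⊆′ : coloured (update σ v a) ⊆ A ∪ ⁅ v ⁆
    col⊆′ u e with u ≟ᶠ v
    ... | yes refl = ∨-introʳ {A u} refl
    ... | no u≢v = ∨-introˡ (col⊆ u e)
    balanced′ : Balanced (update σ v a) A (λ _ → 0)
    balanced′ u σ′u = ≤-trans (balanced u (proj₂ (update-uncoloured σ {v} {a} σ′u)))
      (+-monoˡ-≤ 0 (+-monoˡ-≤ (iverson (A u)) (+-monoʳ-≤ (count (A ∩ before u))
        (count-mono (λ w e → ∧-intro (coloured-update σ a w (∧-elimˡ e)) (∧-elimʳ {coloured σ w} e))))))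

  -- Alice restarts her walk at the vertex b Bob just coloured, or anywhere if b is already active.
  alice-move : ∀ {σ z} → AliceTurn σ → σ z ≡ nothing →
               ∃₂ λ v a → σ v ≡ nothing × Legal G k (update σ v a) × BobTurn (update σ v a)
  alice-move {σ} {z} (A , b , legal , col⊆ , balanced) σz with start (A b) refl
    where
    start : ∀ β → A b ≡ β → ∃₂ λ A′ x → σ x ≡ nothing × Walking σ A′ x
    start true b∈A = A , z , σz , col⊆A , λ v σv → weaken {σ} {A} (balanced v σv) z≤n
      where
      col⊆A : coloured σ ⊆ A ∪ ⁅ z ⁆
      col⊆A u e with ∨-elim {A u} (col⊆ u e)
      ... | inj₁ u∈A = ∨-introˡ u∈A
      ... | inj₂ u∈b = ∨-introˡ (subst (_∈ A) (sym (x∈⁅y⁆⇒x≡y u∈b)) b∈A)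
    start false b∉A with walk-step {σ} {A} (col⊆ , λ v σv → weaken {σ} {A} (balanced v σv) z≤n) b∉A σz
    ... | y , σy , walking = ⁅ b ⁆ ∪ A , y , σy , walking
  ... | A′ , x , σx , walking with walk-to-active n (count≤n _) walking σx
  ...   | A″ , x′ , σx′ , x′∈A″ , walking′ with colour-active legal σx′ x′∈A″ walking′
  ...     | a , legal′ , bob-turn = x′ , a , σx′ , legal′ , bob-turn

  alice-wins : AliceWins G k c
  alice-wins with uncoloured-or-complete (empty {n} {c})
  ... | inj₂ complete = finished complete
  ... | inj₁ (z , _) =
        alice-wins-by-invariant G k AliceTurn BobTurn alice-safe alice-move bob-safe bob-move
          ((λ _ → false) , z , (λ { (_ , _ , _ , mono) → case mono zero of λ () }) , (λ _ ()) ,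
           λ v _ → ≤-trans (≤-reflexive (count-∅ n)) z≤n)

enough-colours : ∀ m k .{{_ : NonZero k}} → m < (m / k + 1) * k
enough-colours m k = begin-strict
  m                      ≡⟨ m≡m%n+[m/n]*n m k ⟩
  m % k + m / k * k      <⟨ +-monoˡ-< (m / k * k) (m%n<n m k) ⟩
  k + m / k * k          ≡⟨ distrib (m / k) k ⟩
  (m / k + 1) * k        ∎
  where
  open ≤-Reasoning
  distrib : ∀ q k → k + q * k ≡ (q + 1) * k
  distrib = solve-∀

corollary3p9 : (k l n : ℕ) .{{_ : NonZero k}} → 1 ≤ l → (G : Graph n) → PartialTree l G →
    AliceWins G k ((3 * l + 2) / k + 1)
corollary3p9 k l n _ G (H , chordal , G⊆H , _ , no-larger-clique) with perfect-elimination-order H chordal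
... | pos , peo =
  Activation.alice-wins G H k l G⊆H pos peo (earlier-degree H pos peo no-larger-clique) (enough-colours (3 * l + 2) k)
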